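{- Let $p$ be an odd prime, let $i$ be a positive even integer prime to $p$ with $i\not\equiv 2\pmod{p-1}$, and let $a$ be an integer with $2\leq a\leq p-1$. For an integer $n$ let $(n)_0$ be its least nonnegative residue modulo $p$, and let $B_i$ be the $i$-th Bernoulli number. Then $$2(a^i-1)\frac{B_i}{i}\equiv\sum_{b=1}^{p-1}\Big((ab)^{i-1}+(ab)_0^{\,i-1}\Big)\left\lfloor\frac{ab}{p}\right\rfloor\pmod{p^2}.$$
   Context: $\lfloor x\rfloor$ is the integer part of $x$; $(ab)^{i-1}$ is the ordinary integer power. Congruences are between rationals with denominators prime to $p$. Bernoulli numbers are defined by $\frac{t}{e^t-1}=\sum_{n\ge0}B_n\frac{t^n}{n!}$. -}

module Defs where

open import Data.Nat using (ℕ; zero; suc; _∸_)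
open import Data.Nat.Combinatorics using (_C_)
open import Data.Nat.Divisibility using (_∣_)
open import Data.Integer using (ℤ; +_)
import Data.Integer as ℤ
open import Data.Rational using (ℚ; _/_; _+_; _*_; -_; _-_; 0ℚ; 1ℚ)
open import Data.List using (List; []; _∷_; foldr; zipWith; upTo; reverse)
open import Data.Product using (Σ; _×_)
open import Relation.Nullary using (¬_)
open import Relation.Binary.PropositionalEquality using (_≡_)

ℕtoℚ : ℕ → ℚ
ℕtoℚ n = + n / 1

sumℚ : List ℚ → ℚ
sumℚ = foldr _+_ 0ℚ

-- Bernoulli numbers (convention t/(e^t-1), so B₁ = -1/2), via the standard
-- recursion equivalent to that generating function:
--   B₀ = 1,   Σ_{k=0}^{m} C(m+1,k) B_k = 0  for m ≥ 1, i.e.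
--   B_m = -(1/(m+1)) Σ_{k<m} C(m+1,k) B_k.
-- bernoulliList m = [B₀, B₁, …, B_m]
nextBernoulli : ℕ → List ℚ → ℚ
nextBernoulli m bs =
  - ((+ 1 / suc m) * sumℚ (zipWith (λ k b → ℕtoℚ (suc m C k) * b) (upTo m) bs))

bernoulliList : ℕ → List ℚ
bernoulliList zero = 1ℚ ∷ []
bernoulliList (suc m) = let bs = bernoulliList m in bs Data.List.++ (nextBernoulli (suc m) bs ∷ [])

lastOr : ℚ → List ℚ → ℚ
lastOr d [] = d
lastOr d (x ∷ []) = x
lastOr d (x ∷ y ∷ ys) = lastOr d (y ∷ ys)

bernoulli : ℕ → ℚ
bernoulli m = lastOr 0ℚ (bernoulliList m)

-- Congruence of rationals modulo p^k (for denominators prime to p):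
-- x ≡ y (mod p^k) iff x - y = p^k · u / v with u ∈ ℤ, v ∈ ℕ, p ∤ v.
CongQ : (p k : ℕ) → ℚ → ℚ → Set
CongQ p k x y =
  Σ ℤ λ u → Σ ℕ λ v → (¬ (p ∣ v)) × ((x - y) * ℕtoℚ v ≡ (u ℤ.* (+ (p Data.Nat.^ k))) / 1)

sumFrom1 : ℕ → (ℕ → ℕ) → ℕ
sumFrom1 zero f = 0
sumFrom1 (suc n) f = sumFrom1 n f Data.Nat.+ f (suc n)

module Submission where

-- Faulhaber's formula Σ_{b<p} b^k = Σ_j C(k,j) B_j p^(k+1-j)/(k+1-j), with the p-adic size of
-- p^(m-1)/m, shows that p B_j is p-integral and S_k := Σ_{b<p} b^k ≡ p B_k (mod p); with Fermat, S_k ≡ 0 (mod p)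
-- when p-1 ∤ k. For N = i this gives S_(N-2) ≡ 0 (mod p), then S_(N-1) ≡ 0 (mod p²) by pairing b with p-b,
-- hence B_(N-1) ≡ 0 (mod p), and finally S_N ≡ p B_N (mod p³).
-- On the other side, ab = (ab)₀ + p⌊ab/p⌋ and a second-order (trapezoid) expansion give
-- N p Σ_b ((ab)^(N-1) + (ab)₀^(N-1)) ⌊ab/p⌋ ≡ 2 Σ_b ((ab)^N - (ab)₀^N) = 2 (a^N - 1) S_N (mod p³),
-- as b ↦ (ab)₀ permutes the nonzero residues. Comparing and dividing by p N yields the congruence mod p².

module BinomialIdentities where

  open import Data.Nat
  import Data.Nat.Properties as ℕP
  open ℕP using (_!≢0; _!*_!≢0)
  open import Data.Nat.Combinatorics
  open import Relation.Binary.PropositionalEquality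
  open import Data.Nat.DivMod using (m/n*n≡m; m/n/o≡m/[n*o]; /-congˡ)
  open import Data.Nat.Tactic.RingSolver using (solve-∀)

  nCk*[n∸k]!*k!≡n! : ∀ {n k} → k ≤ n → (n C k) * ((n ∸ k) ! * k !) ≡ n !
  nCk*[n∸k]!*k!≡n! {n} {k} k≤n = begin
    (n C k) * ((n ∸ k) ! * k !)                   ≡⟨ cong (_* ((n ∸ k) ! * k !)) nCk≡quotient ⟩
    (n ! / ((n ∸ k) ! * k !)) * ((n ∸ k) ! * k !) ≡⟨ m/n*n≡m ([n∸k]!k!∣n! k≤n) ⟩
    n !                                           ∎
    where
    open ≡-Reasoning
    instance
      _ = (n ∸ k) !≢0
      _ = k !≢0
      _ = (n ∸ k) !* k !≢0
    nCk≡quotient : n C k ≡ n ! / ((n ∸ k) ! * k !)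
    nCk≡quotient = trans (nCk≡nPk/k! k≤n) (trans (/-congˡ (nPk≡n!/[n∸k]! k≤n)) (m/n/o≡m/[n*o] (n !) ((n ∸ k) !) (k !)))

  nCk*[n∸k]Cj≡nCj*[n∸j]Ck : ∀ n k j → k + j ≤ n → (n C k) * ((n ∸ k) C j) ≡ (n C j) * ((n ∸ j) C k)
  nCk*[n∸k]Cj≡nCj*[n∸j]Ck n k j k+j≤n =
    ℕP.*-cancelʳ-≡ _ _ (r ! * (j ! * k !)) {{ℕP.m*n≢0 (r !) (j ! * k !) {{r !≢0}} {{j !* k !≢0}}}}
      (trans (both-≡-n! k j refl k+j≤n)
        (sym (trans (cong (λ t → (n C j) * ((n ∸ j) C k) * (r ! * t)) (ℕP.*-comm (j !) (k !)))
          (both-≡-n! j k (cong (n ∸_) (ℕP.+-comm j k)) (subst (_≤ n) (ℕP.+-comm k j) k+j≤n)))))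
    where
    r = n ∸ (k + j)
    both-≡-n! : ∀ a b → n ∸ (a + b) ≡ r → a + b ≤ n →
      (n C a) * ((n ∸ a) C b) * (r ! * (b ! * a !)) ≡ n !
    both-≡-n! a b eq a+b≤n = begin
      (n C a) * ((n ∸ a) C b) * (r ! * (b ! * a !))   ≡⟨ reassoc (n C a) ((n ∸ a) C b) (r !) (b !) (a !) ⟩
      (n C a) * (((n ∸ a) C b) * (r ! * b !) * a !)   ≡⟨ cong (λ t → (n C a) * (((n ∸ a) C b) * (t ! * b !) * a !)) r≡ ⟩
      (n C a) * (((n ∸ a) C b) * ((n ∸ a ∸ b) ! * b !) * a !)
        ≡⟨ cong (λ t → (n C a) * (t * a !)) (nCk*[n∸k]!*k!≡n! (ℕP.m+n≤o⇒m≤o∸n b (subst (_≤ n) (ℕP.+-comm a b) a+b≤n))) ⟩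
      (n C a) * ((n ∸ a) ! * a !)                      ≡⟨ nCk*[n∸k]!*k!≡n! (ℕP.≤-trans (ℕP.m≤m+n a b) a+b≤n) ⟩
      n !                                              ∎
      where
      open ≡-Reasoning
      r≡ : r ≡ n ∸ a ∸ b
      r≡ = trans (sym eq) (sym (ℕP.∸-+-assoc n a b))
      reassoc : ∀ u v w x y → u * v * (w * (x * y)) ≡ u * (v * (w * x) * y)
      reassoc = solve-∀

  [1+m∸k]*[1+m]Ck≡[1+m]*mCk : ∀ m k → k ≤ m → (suc m ∸ k) * (suc m C k) ≡ suc m * (m C k)
  [1+m∸k]*[1+m]Ck≡[1+m]*mCk m k k≤m = ℕP.*-cancelʳ-≡ _ _ ((m ∸ k) ! * k !) {{(m ∸ k) !* k !≢0}}
    (trans lhs (sym (trans (ℕP.*-assoc (suc m) (m C k) _) (cong (suc m *_) (nCk*[n∸k]!*k!≡n! k≤m)))))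
    where
    1+m∸k≡ : suc m ∸ k ≡ suc (m ∸ k)
    1+m∸k≡ = ℕP.+-∸-assoc 1 k≤m
    reassoc : ∀ a b x y → (a * b) * (x * y) ≡ b * ((a * x) * y)
    reassoc = solve-∀
    lhs : (suc m ∸ k) * (suc m C k) * ((m ∸ k) ! * k !) ≡ (suc m) !
    lhs = trans (reassoc (suc m ∸ k) (suc m C k) ((m ∸ k) !) (k !))
      (trans (cong (λ t → (suc m C k) * (t * (m ∸ k) ! * k !)) 1+m∸k≡)
        (trans (cong (λ t → (suc m C k) * (t ! * k !)) (sym 1+m∸k≡)) (nCk*[n∸k]!*k!≡n! (ℕP.m≤n⇒m≤1+n k≤m))))

  [1+m]*m≡2*[1+m]C2 : ∀ m → suc m * m ≡ 2 * (suc m C 2)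
  [1+m]*m≡2*[1+m]C2 zero    = refl
  [1+m]*m≡2*[1+m]C2 (suc m) = begin
    suc (suc m) * suc m             ≡⟨ expand m ⟩
    2 * suc m + suc m * m           ≡⟨ cong (2 * suc m +_) ([1+m]*m≡2*[1+m]C2 m) ⟩
    2 * suc m + 2 * (suc m C 2)     ≡⟨ ℕP.*-distribˡ-+ 2 (suc m) (suc m C 2) ⟨
    2 * (suc m + suc m C 2)         ≡⟨ cong (λ t → 2 * (t + suc m C 2)) (nC1≡n (suc m)) ⟨
    2 * (suc m C 1 + suc m C 2)     ≡⟨ cong (2 *_) (nCk+nC[k+1]≡[n+1]C[k+1] (suc m) 1) ⟩
    2 * (suc (suc m) C 2)           ∎
    where
    open ≡-Reasoning
    expand : ∀ m → suc (suc m) * suc m ≡ 2 * suc m + suc m * m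
    expand = solve-∀

  [1+n]Cn≡1+n : ∀ n → suc n C n ≡ suc n
  [1+n]Cn≡1+n n = trans (nCk≡nC[n∸k] (ℕP.n≤1+n n)) (trans (cong (suc n C_) (ℕP.m+n∸n≡m 1 n)) (nC1≡n (suc n)))

module PowerSumCongruences where

  open import Level using (0ℓ)
  open import Data.Empty using (⊥-elim)
  open import Data.Sum using (inj₁; inj₂)
  open import Data.Product using (_,_; _×_; ∃₂)
  open import Data.List using ([]; _∷_; _∷ʳ_; _++_; applyUpTo; zipWith)
  open import Data.List.Properties using (applyUpTo-∷ʳ)
  open import Data.Nat as ℕ using (ℕ; zero; suc; NonZero; _≤_; _<_; z≤n; s≤s; _∸_; _!; nonTrivial⇒n>1)
  import Data.Nat.Properties as ℕP
  open import Data.Nat.Induction using (<-rec)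
  open import Data.Nat.Divisibility using (_∣_; _∣?_; divides; ∣⇒≤; ∣1⇒≡1; m%n≡0⇒n∣m)
  open import Data.Nat.DivMod using (_%_; _/_; m≡m%n+[m/n]*n; m%n<n)
  open import Data.Nat.Combinatorics using (_C_; nCn≡1; nC1≡n; k>n⇒nCk≡0; nCk+nC[k+1]≡[n+1]C[k+1])
  open import Data.Nat.Primality
    using (Prime; euclidsLemma; ¬prime[0]; ¬prime[1]; prime⇒nonTrivial; composite⇒¬prime; composite[4])
  open import Data.Integer as ℤ using (ℤ; +_)
  import Data.Integer.Properties as ℤP
  open import Data.Rational as ℚ using (ℚ; _+_; _*_; -_; _-_; 0ℚ; 1ℚ; toℚᵘ)
  import Data.Rational.Properties as ℚP
  import Data.Rational.Unnormalised as ℚᵘ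
  import Data.Rational.Unnormalised.Properties as ℚᵘP
  open import Algebra.Bundles using (CommutativeRing)
  open import Algebra.Properties.CommutativeSemiring.Exp (CommutativeRing.commutativeSemiring ℚP.+-*-commutativeRing)
    using (_^_; ^-homo-*; ^-assocʳ; ^-distrib-*)
  open import Relation.Nullary using (¬_; yes; no; dec⇒maybe)
  open import Relation.Binary.PropositionalEquality
  open import Tactic.RingSolver using (solve-∀)
  open import Tactic.RingSolver.Core.AlmostCommutativeRing using (AlmostCommutativeRing; fromCommutativeRing)
  open import Defs
  open BinomialIdentities

  ℚ-ring : AlmostCommutativeRing 0ℓ 0ℓ
  ℚ-ring = fromCommutativeRing ℚP.+-*-commutativeRing (λ x → dec⇒maybe (0ℚ ℚ.≟ x))

  ℤtoℚ : ℤ → ℚ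
  ℤtoℚ z = z ℚ./ 1

  toℚᵘ-ℤtoℚ : ∀ z → toℚᵘ (ℤtoℚ z) ℚᵘ.≃ ℚᵘ.mkℚᵘ z 0
  toℚᵘ-ℤtoℚ z = ℚP.toℚᵘ-fromℚᵘ (ℚᵘ.mkℚᵘ z 0)

  ℤtoℚ-+ : ∀ a b → ℤtoℚ (a ℤ.+ b) ≡ ℤtoℚ a + ℤtoℚ b
  ℤtoℚ-+ a b = ℚP.toℚᵘ-injective (ℚᵘP.≃-trans (toℚᵘ-ℤtoℚ (a ℤ.+ b))
    (ℚᵘP.≃-trans integral (ℚᵘP.≃-sym (ℚᵘP.≃-trans (ℚP.toℚᵘ-homo-+ (ℤtoℚ a) (ℤtoℚ b))
      (ℚᵘP.+-cong (toℚᵘ-ℤtoℚ a) (toℚᵘ-ℤtoℚ b))))))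
    where
    integral : ℚᵘ.mkℚᵘ (a ℤ.+ b) 0 ℚᵘ.≃ ℚᵘ.mkℚᵘ a 0 ℚᵘ.+ ℚᵘ.mkℚᵘ b 0
    integral = ℚᵘ.*≡* (cong (ℤ._* + 1) (cong₂ ℤ._+_ (sym (ℤP.*-identityʳ a)) (sym (ℤP.*-identityʳ b))))

  ℤtoℚ-* : ∀ a b → ℤtoℚ (a ℤ.* b) ≡ ℤtoℚ a * ℤtoℚ b
  ℤtoℚ-* a b = ℚP.toℚᵘ-injective (ℚᵘP.≃-trans (toℚᵘ-ℤtoℚ (a ℤ.* b))
    (ℚᵘP.≃-sym (ℚᵘP.≃-trans (ℚP.toℚᵘ-homo-* (ℤtoℚ a) (ℤtoℚ b))
      (ℚᵘP.*-cong (toℚᵘ-ℤtoℚ a) (toℚᵘ-ℤtoℚ b)))))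

  ℤtoℚ-neg : ∀ a → ℤtoℚ (ℤ.- a) ≡ - ℤtoℚ a
  ℤtoℚ-neg a = ℚP.toℚᵘ-injective (ℚᵘP.≃-trans (toℚᵘ-ℤtoℚ (ℤ.- a))
    (ℚᵘP.≃-sym (ℚᵘP.≃-trans (ℚP.toℚᵘ-homo‿- (ℤtoℚ a)) (ℚᵘP.-‿cong (toℚᵘ-ℤtoℚ a)))))

  ℕtoℚ-+ : ∀ m n → ℕtoℚ (m ℕ.+ n) ≡ ℕtoℚ m + ℕtoℚ n
  ℕtoℚ-+ m n = ℤtoℚ-+ (+ m) (+ n)

  ℕtoℚ-* : ∀ m n → ℕtoℚ (m ℕ.* n) ≡ ℕtoℚ m * ℕtoℚ n
  ℕtoℚ-* m n = trans (cong ℤtoℚ (ℤP.pos-* m n)) (ℤtoℚ-* (+ m) (+ n))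

  ℕtoℚ-suc : ∀ n → ℕtoℚ (suc n) ≡ ℕtoℚ n + 1ℚ
  ℕtoℚ-suc n = trans (ℕtoℚ-+ 1 n) (ℚP.+-comm 1ℚ (ℕtoℚ n))

  ℕtoℚ-∸ : ∀ m n → n ≤ m → ℕtoℚ (m ∸ n) ≡ ℕtoℚ m - ℕtoℚ n
  ℕtoℚ-∸ m n n≤m = begin
    ℕtoℚ (m ∸ n)                   ≡⟨ add-sub (ℕtoℚ (m ∸ n)) (ℕtoℚ n) ⟩
    (ℕtoℚ (m ∸ n) + ℕtoℚ n) - ℕtoℚ n ≡⟨ cong (_- ℕtoℚ n) (sym (ℕtoℚ-+ (m ∸ n) n)) ⟩
    ℕtoℚ (m ∸ n ℕ.+ n) - ℕtoℚ n     ≡⟨ cong (λ k → ℕtoℚ k - ℕtoℚ n) (ℕP.m∸n+n≡m n≤m) ⟩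
    ℕtoℚ m - ℕtoℚ n                ∎
    where
    open ≡-Reasoning
    add-sub : ∀ (x y : ℚ) → x ≡ (x + y) - y
    add-sub = solve-∀ ℚ-ring

  ℕtoℚ-^ : ∀ m n → ℕtoℚ (m ℕ.^ n) ≡ ℕtoℚ m ^ n
  ℕtoℚ-^ m zero    = refl
  ℕtoℚ-^ m (suc n) = trans (ℕtoℚ-* m (m ℕ.^ n)) (cong (ℕtoℚ m *_) (ℕtoℚ-^ m n))

  ℕtoℚ-divMod : ∀ a n .{{_ : NonZero n}} → ℕtoℚ a ≡ ℕtoℚ (a % n) + ℕtoℚ n * ℕtoℚ (a / n)
  ℕtoℚ-divMod a n = trans (cong ℕtoℚ (m≡m%n+[m/n]*n a n)) (trans (ℕtoℚ-+ (a % n) (a / n ℕ.* n))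
    (cong (_+_ (ℕtoℚ (a % n))) (trans (ℕtoℚ-* (a / n) n) (ℚP.*-comm (ℕtoℚ (a / n)) (ℕtoℚ n)))))

  0^-positive : ∀ n → 0 < n → 0ℚ ^ n ≡ 0ℚ
  0^-positive (suc n) _ = ℚP.*-zeroˡ (0ℚ ^ n)

  1/_ : (m : ℕ) → .{{NonZero m}} → ℚ
  1/ m = + 1 ℚ./ m

  *-1/ : ∀ m .{{_ : NonZero m}} → ℕtoℚ m * 1/ m ≡ 1ℚ
  *-1/ (suc m) = ℚP.toℚᵘ-injective (ℚᵘP.≃-trans (ℚP.toℚᵘ-homo-* (ℕtoℚ (suc m)) (1/ suc m))
    (ℚᵘP.≃-trans (ℚᵘP.*-cong (toℚᵘ-ℤtoℚ (+ suc m)) (ℚP.toℚᵘ-fromℚᵘ (ℚᵘ.mkℚᵘ (+ 1) m)))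
      (ℚᵘ.*≡* (trans (ℤP.*-identityʳ _) (trans (ℤP.*-identityʳ _)
        (trans (cong +_ (sym (ℕP.*-identityˡ (suc m)))) (sym (ℤP.*-identityˡ _))))))))

  1/-* : ∀ m .{{_ : NonZero m}} x → 1/ m * (ℕtoℚ m * x) ≡ x
  1/-* m x = begin
    1/ m * (ℕtoℚ m * x) ≡⟨ sym (ℚP.*-assoc (1/ m) (ℕtoℚ m) x) ⟩
    (1/ m * ℕtoℚ m) * x ≡⟨ cong (_* x) (trans (ℚP.*-comm (1/ m) (ℕtoℚ m)) (*-1/ m)) ⟩
    1ℚ * x              ≡⟨ ℚP.*-identityˡ x ⟩
    x                   ∎
    where open ≡-Reasoning

  -- Finite sums and products

  module BigOperator {A : Set} (_∙_ : A → A → A) (ε : A)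
    (∙-assoc : ∀ x y z → (x ∙ y) ∙ z ≡ x ∙ (y ∙ z)) (∙-comm : ∀ x y → x ∙ y ≡ y ∙ x) where

    big : ℕ → (ℕ → A) → A
    big zero    f = ε
    big (suc n) f = big n f ∙ f n

    big-cong : ∀ n {f g : ℕ → A} → (∀ k → k < n → f k ≡ g k) → big n f ≡ big n g
    big-cong zero    f≗g = refl
    big-cong (suc n) f≗g = cong₂ _∙_ (big-cong n (λ k k<n → f≗g k (ℕP.m<n⇒m<1+n k<n))) (f≗g n (ℕP.n<1+n n))

    private
      ∙-swapʳ : ∀ x y z → (x ∙ y) ∙ z ≡ (x ∙ z) ∙ y
      ∙-swapʳ x y z = trans (∙-assoc x y z) (trans (cong (x ∙_) (∙-comm y z)) (sym (∙-assoc x z y)))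

    _[_≔_] : (ℕ → A) → ℕ → A → ℕ → A
    (f [ m ≔ a ]) k with k ℕ.≟ m
    ... | yes _ = a
    ... | no  _ = f k

    big-update : ∀ n m a f → m < n → big n (f [ m ≔ a ]) ∙ f m ≡ big n f ∙ a
    big-update (suc n) m a f (s≤s m≤n) with ℕP.m≤n⇒m<n∨m≡n m≤n
    ... | inj₂ refl = begin
      (big m (f [ m ≔ a ]) ∙ (f [ m ≔ a ]) m) ∙ f m ≡⟨ cong₂ (λ s t → (s ∙ t) ∙ f m) (big-cong m elsewhere) at-m ⟩
      (big m f ∙ a) ∙ f m                           ≡⟨ ∙-swapʳ (big m f) a (f m) ⟩
      (big m f ∙ f m) ∙ a                           ∎
      where
      open ≡-Reasoning
      elsewhere : ∀ k → k < m → (f [ m ≔ a ]) k ≡ f k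
      elsewhere k k<m with k ℕ.≟ m
      ... | yes k≡m = ⊥-elim (ℕP.<⇒≢ k<m k≡m)
      ... | no  _   = refl
      at-m : (f [ m ≔ a ]) m ≡ a
      at-m with m ℕ.≟ m
      ... | yes _   = refl
      ... | no  m≢m = ⊥-elim (m≢m refl)
    ... | inj₁ m<n = begin
      (big n (f [ m ≔ a ]) ∙ (f [ m ≔ a ]) n) ∙ f m ≡⟨ cong (λ t → (big n (f [ m ≔ a ]) ∙ t) ∙ f m) at-n ⟩
      (big n (f [ m ≔ a ]) ∙ f n) ∙ f m             ≡⟨ ∙-swapʳ _ (f n) (f m) ⟩
      (big n (f [ m ≔ a ]) ∙ f m) ∙ f n             ≡⟨ cong (_∙ f n) (big-update n m a f m<n) ⟩
      (big n f ∙ a) ∙ f n                           ≡⟨ ∙-swapʳ (big n f) a (f n) ⟩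
      (big n f ∙ f n) ∙ a                           ∎
      where
      open ≡-Reasoning
      at-n : (f [ m ≔ a ]) n ≡ f n
      at-n with n ℕ.≟ m
      ... | yes n≡m = ⊥-elim (ℕP.<⇒≢ m<n (sym n≡m))
      ... | no  _   = refl

    transpose : ℕ → ℕ → ℕ → ℕ
    transpose m n k with k ℕ.≟ m
    ... | yes _ = n
    ... | no  _ with k ℕ.≟ n
    ...   | yes _ = m
    ...   | no  _ = k

    transpose-involutive : ∀ m n k → transpose m n (transpose m n k) ≡ k
    transpose-involutive m n k with k ℕ.≟ m
    transpose-involutive m n k | yes k≡m with n ℕ.≟ m
    ... | yes n≡m = trans n≡m (sym k≡m)
    ... | no  _ with n ℕ.≟ n
    ...   | yes _   = sym k≡m
    ...   | no  n≢n = ⊥-elim (n≢n refl)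
    transpose-involutive m n k | no k≢m with k ℕ.≟ n
    transpose-involutive m n k | no k≢m | yes k≡n with m ℕ.≟ m
    ... | yes _   = sym k≡n
    ... | no  m≢m = ⊥-elim (m≢m refl)
    transpose-involutive m n k | no k≢m | no k≢n with k ℕ.≟ m
    ... | yes k≡m = ⊥-elim (k≢m k≡m)
    ... | no  _ with k ℕ.≟ n
    ...   | yes k≡n = ⊥-elim (k≢n k≡n)
    ...   | no  _   = refl

    transpose-injective : ∀ m n {k l} → transpose m n k ≡ transpose m n l → k ≡ l
    transpose-injective m n {k} {l} eq =
      trans (sym (transpose-involutive m n k)) (trans (cong (transpose m n) eq) (transpose-involutive m n l))

    transpose-applyˡ : ∀ m n → transpose m n m ≡ n
    transpose-applyˡ m n with m ℕ.≟ m
    ... | yes _   = refl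
    ... | no  m≢m = ⊥-elim (m≢m refl)

    transpose-applyʳ : ∀ m n → transpose m n n ≡ m
    transpose-applyʳ m n with n ℕ.≟ m
    ... | yes n≡m = n≡m
    ... | no  _ with n ℕ.≟ n
    ...   | yes _   = refl
    ...   | no  n≢n = ⊥-elim (n≢n refl)

    transpose-≤ : ∀ {m n k} → m ≤ n → k ≤ n → transpose m n k ≤ n
    transpose-≤ {m} {n} {k} m≤n k≤n with k ℕ.≟ m
    ... | yes _ = ℕP.≤-refl
    ... | no  _ with k ℕ.≟ n
    ...   | yes _ = m≤n
    ...   | no  _ = k≤n

    big-transpose : ∀ n m f → m ≤ n → big (suc n) (λ k → f (transpose m n k)) ≡ big (suc n) f
    big-transpose n m f m≤n with ℕP.m≤n⇒m<n∨m≡n m≤n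
    ... | inj₂ refl = big-cong (suc m) (λ k _ → cong f (transpose-self k))
      where
      transpose-self : ∀ k → transpose m m k ≡ k
      transpose-self k with k ℕ.≟ m
      ... | yes k≡m = sym k≡m
      ... | no  _ with k ℕ.≟ m
      ...   | yes k≡m = sym k≡m
      ...   | no  _   = refl
    ... | inj₁ m<n = begin
      big n (λ k → f (transpose m n k)) ∙ f (transpose m n n) ≡⟨ cong₂ _∙_ (big-cong n below-n) (cong f (transpose-applyʳ m n)) ⟩
      big n (f [ m ≔ f n ]) ∙ f m                             ≡⟨ big-update n m (f n) f m<n ⟩
      big n f ∙ f n                                           ∎
      where
      open ≡-Reasoning
      below-n : ∀ k → k < n → f (transpose m n k) ≡ (f [ m ≔ f n ]) k
      below-n k k<n with k ℕ.≟ m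
      ... | yes _ = refl
      ... | no  _ with k ℕ.≟ n
      ...   | yes k≡n = ⊥-elim (ℕP.<⇒≢ k<n k≡n)
      ...   | no  _   = refl

    big-permute : ∀ n (σ : ℕ → ℕ) (f : ℕ → A) →
      (∀ k → k < n → σ k < n) →
      (∀ k l → k < n → l < n → σ k ≡ σ l → k ≡ l) →
      big n (λ k → f (σ k)) ≡ big n f
    big-permute zero    σ f σ-range σ-inj = refl
    big-permute (suc n) σ f σ-range σ-inj = begin
      big n (λ k → f (σ k)) ∙ f m
        ≡⟨ cong (_∙ f m) (big-cong n (λ k _ → cong f (sym (transpose-involutive m n (σ k))))) ⟩
      big n (λ k → f (transpose m n (τ k))) ∙ f m
        ≡⟨ cong (_∙ f m) (big-permute n τ (λ k → f (transpose m n k)) τ-range τ-inj) ⟩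
      big n (λ k → f (transpose m n k)) ∙ f m
        ≡⟨ cong (λ t → big n (λ k → f (transpose m n k)) ∙ f t) (sym (transpose-applyʳ m n)) ⟩
      big (suc n) (λ k → f (transpose m n k))
        ≡⟨ big-transpose n m f m≤n ⟩
      big (suc n) f ∎
      where
      open ≡-Reasoning
      m = σ n
      m≤n : m ≤ n
      m≤n = ℕP.≤-pred (σ-range n (ℕP.n<1+n n))
      τ : ℕ → ℕ
      τ k = transpose m n (σ k)
      τ-inj : ∀ k l → k < n → l < n → τ k ≡ τ l → k ≡ l
      τ-inj k l k<n l<n eq = σ-inj k l (ℕP.m<n⇒m<1+n k<n) (ℕP.m<n⇒m<1+n l<n) (transpose-injective m n eq)
      τ-range : ∀ k → k < n → τ k < n
      τ-range k k<n with ℕP.m≤n⇒m<n∨m≡n (transpose-≤ m≤n (ℕP.≤-pred (σ-range k (ℕP.m<n⇒m<1+n k<n))))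
      ... | inj₁ τk<n = τk<n
      ... | inj₂ τk≡n = ⊥-elim (ℕP.<⇒≢ k<n (τ-inj′ τk≡n))
        where
        τ-inj′ : τ k ≡ n → k ≡ n
        τ-inj′ eq = σ-inj k n (ℕP.m<n⇒m<1+n k<n) (ℕP.n<1+n n)
          (transpose-injective m n (trans eq (sym (transpose-applyˡ m n))))

  open BigOperator _+_ 0ℚ ℚP.+-assoc ℚP.+-comm public
    using () renaming (big to ∑; big-cong to ∑-cong; big-permute to ∑-permute)
  open BigOperator _*_ 1ℚ ℚP.*-assoc ℚP.*-comm public
    using () renaming (big to ∏; big-cong to ∏-cong; big-permute to ∏-permute)

  ∏-distrib-* : ∀ n (f g : ℕ → ℚ) → ∏ n (λ k → f k * g k) ≡ ∏ n f * ∏ n g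
  ∏-distrib-* zero    f g = refl
  ∏-distrib-* (suc n) f g = trans (cong (_* (f n * g n)) (∏-distrib-* n f g)) (interchange (∏ n f) (∏ n g) (f n) (g n))
    where
    interchange : ∀ (a b c d : ℚ) → (a * b) * (c * d) ≡ (a * c) * (b * d)
    interchange = solve-∀ ℚ-ring

  ∏-const : ∀ n x → ∏ n (λ _ → x) ≡ x ^ n
  ∏-const zero    x = refl
  ∏-const (suc n) x = trans (cong (_* x) (∏-const n x)) (ℚP.*-comm (x ^ n) x)

  ∏-suc≡! : ∀ n → ∏ n (λ k → ℕtoℚ (suc k)) ≡ ℕtoℚ (n !)
  ∏-suc≡! zero    = refl
  ∏-suc≡! (suc n) = trans (cong (_* ℕtoℚ (suc n)) (∏-suc≡! n))
    (trans (ℚP.*-comm (ℕtoℚ (n !)) (ℕtoℚ (suc n))) (sym (ℕtoℚ-* (suc n) (n !))))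

  ∑-zero : ∀ n → ∑ n (λ _ → 0ℚ) ≡ 0ℚ
  ∑-zero zero    = refl
  ∑-zero (suc n) = trans (ℚP.+-identityʳ _) (∑-zero n)

  ∑-distrib-+ : ∀ n (f g : ℕ → ℚ) → ∑ n (λ k → f k + g k) ≡ ∑ n f + ∑ n g
  ∑-distrib-+ zero    f g = refl
  ∑-distrib-+ (suc n) f g = trans (cong (_+ (f n + g n)) (∑-distrib-+ n f g)) (interchange (∑ n f) (∑ n g) (f n) (g n))
    where
    interchange : ∀ (a b c d : ℚ) → (a + b) + (c + d) ≡ (a + c) + (b + d)
    interchange = solve-∀ ℚ-ring

  ∑-distrib-neg : ∀ n (f : ℕ → ℚ) → ∑ n (λ k → - f k) ≡ - ∑ n f
  ∑-distrib-neg zero    f = refl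
  ∑-distrib-neg (suc n) f = trans (cong (_+ (- f n)) (∑-distrib-neg n f)) (sym (ℚP.neg-distrib-+ (∑ n f) (f n)))

  ∑-distrib-- : ∀ n (f g : ℕ → ℚ) → ∑ n (λ k → f k - g k) ≡ ∑ n f - ∑ n g
  ∑-distrib-- n f g = trans (∑-distrib-+ n f (λ k → - g k)) (cong (_+_ (∑ n f)) (∑-distrib-neg n g))

  *-distribˡ-∑ : ∀ n (c : ℚ) (f : ℕ → ℚ) → c * ∑ n f ≡ ∑ n (λ k → c * f k)
  *-distribˡ-∑ zero    c f = ℚP.*-zeroʳ c
  *-distribˡ-∑ (suc n) c f = trans (ℚP.*-distribˡ-+ c (∑ n f) (f n)) (cong (_+ c * f n) (*-distribˡ-∑ n c f))

  ∑-unconsˡ : ∀ n (f : ℕ → ℚ) → ∑ (suc n) f ≡ f 0 + ∑ n (λ k → f (suc k))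
  ∑-unconsˡ zero    f = trans (ℚP.+-identityˡ (f 0)) (sym (ℚP.+-identityʳ (f 0)))
  ∑-unconsˡ (suc n) f = trans (cong (_+ f (suc n)) (∑-unconsˡ n f)) (ℚP.+-assoc (f 0) _ _)

  ∑-comm : ∀ m n (f : ℕ → ℕ → ℚ) → ∑ m (λ i → ∑ n (f i)) ≡ ∑ n (λ j → ∑ m (λ i → f i j))
  ∑-comm zero    n f = sym (∑-zero n)
  ∑-comm (suc m) n f = trans (cong (_+ ∑ n (f m)) (∑-comm m n f))
    (sym (∑-distrib-+ n (λ j → ∑ m (λ i → f i j)) (f m)))

  ∑-reverse : ∀ n (f : ℕ → ℚ) → ∑ n f ≡ ∑ n (λ k → f (n ∸ suc k))
  ∑-reverse zero    f = refl
  ∑-reverse (suc n) f = begin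
    ∑ n f + f n                     ≡⟨ cong (_+ f n) (∑-reverse n f) ⟩
    ∑ n (λ k → f (n ∸ suc k)) + f n ≡⟨ ℚP.+-comm _ (f n) ⟩
    f n + ∑ n (λ k → f (n ∸ suc k)) ≡⟨ ∑-unconsˡ n (λ k → f (n ∸ k)) ⟨
    ∑ (suc n) (λ k → f (n ∸ k))     ∎
    where open ≡-Reasoning

  ∑-telescope : ∀ n (f : ℕ → ℚ) → ∑ n (λ k → f (suc k) - f k) ≡ f n - f 0
  ∑-telescope zero    f = sym (ℚP.+-inverseʳ (f 0))
  ∑-telescope (suc n) f = trans (cong (_+ (f (suc n) - f n)) (∑-telescope n f)) (cancel (f n) (f 0) (f (suc n)))
    where
    cancel : ∀ (a b c : ℚ) → (a - b) + (c - a) ≡ c - b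
    cancel = solve-∀ ℚ-ring

  restrict : ℕ → (ℕ → ℚ) → ℕ → ℚ
  restrict L f k with k ℕ.<? L
  ... | yes _ = f k
  ... | no  _ = 0ℚ

  ∑-restrict : ∀ n L (f : ℕ → ℚ) → L ≤ n → ∑ n (restrict L f) ≡ ∑ L f
  ∑-restrict zero .zero f z≤n = refl
  ∑-restrict (suc n) L f L≤1+n with ℕP.m≤n⇒m<n∨m≡n L≤1+n
  ... | inj₂ refl = ∑-cong (suc n) inside
    where
    inside : ∀ k → k < suc n → restrict (suc n) f k ≡ f k
    inside k k<L with k ℕ.<? suc n
    ... | yes _   = refl
    ... | no  k≮L = ⊥-elim (k≮L k<L)
  ... | inj₁ (s≤s L≤n) = trans (cong₂ _+_ (∑-restrict n L f L≤n) outside) (ℚP.+-identityʳ _)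
    where
    outside : restrict L f n ≡ 0ℚ
    outside with n ℕ.<? L
    ... | yes n<L = ⊥-elim (ℕP.<⇒≱ n<L L≤n)
    ... | no  _   = refl

  ∑-comm-triangle : ∀ M (f : ℕ → ℕ → ℚ) →
    ∑ M (λ k → ∑ (M ∸ k) (f k)) ≡ ∑ M (λ j → ∑ (M ∸ j) (λ k → f k j))
  ∑-comm-triangle M f = begin
    ∑ M (λ k → ∑ (M ∸ k) (f k))
      ≡⟨ ∑-cong M (λ k _ → ∑-restrict M (M ∸ k) (f k) (ℕP.m∸n≤m M k)) ⟨
    ∑ M (λ k → ∑ M (restrict (M ∸ k) (f k)))
      ≡⟨ ∑-cong M (λ k _ → ∑-cong M (λ j _ → restrict-swap k j)) ⟩
    ∑ M (λ k → ∑ M (λ j → restrict (M ∸ j) (λ k′ → f k′ j) k))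
      ≡⟨ ∑-comm M M _ ⟩
    ∑ M (λ j → ∑ M (restrict (M ∸ j) (λ k → f k j)))
      ≡⟨ ∑-cong M (λ j _ → ∑-restrict M (M ∸ j) (λ k → f k j) (ℕP.m∸n≤m M j)) ⟩
    ∑ M (λ j → ∑ (M ∸ j) (λ k → f k j)) ∎
    where
    open ≡-Reasoning
    below-swap : ∀ a b → a < M ∸ b → b < M ∸ a
    below-swap a b a<M-b = ℕP.m+n≤o⇒m≤o∸n (suc b)
      (subst (_≤ M) (cong suc (ℕP.+-comm a b)) (ℕP.m≤o∸n⇒m+n≤o (suc a) b≤M a<M-b))
      where
      b≤M : b ≤ M
      b≤M = ℕP.<⇒≤ (ℕP.m∸n≢0⇒n<m (ℕP.>⇒≢ (ℕP.≤-trans (s≤s z≤n) a<M-b)))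
    restrict-swap : ∀ k j → restrict (M ∸ k) (f k) j ≡ restrict (M ∸ j) (λ k′ → f k′ j) k
    restrict-swap k j with j ℕ.<? M ∸ k | k ℕ.<? M ∸ j
    ... | yes _   | yes _   = refl
    ... | no  _   | no  _   = refl
    ... | yes j<  | no  k≮  = ⊥-elim (k≮ (below-swap j k j<))
    ... | no  j≮  | yes k<  = ⊥-elim (j≮ (below-swap k j k<))

  ℕtoℚ-sumFrom1 : ∀ n (g : ℕ → ℕ) → ℕtoℚ (sumFrom1 n g) ≡ ∑ n (λ c → ℕtoℚ (g (suc c)))
  ℕtoℚ-sumFrom1 zero    g = refl
  ℕtoℚ-sumFrom1 (suc n) g = trans (ℕtoℚ-+ (sumFrom1 n g) (g (suc n))) (cong (_+ ℕtoℚ (g (suc n))) (ℕtoℚ-sumFrom1 n g))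

  -- Bernoulli numbers and Faulhaber's formula

  binomial-+1 : ∀ x e → (x + 1ℚ) ^ e ≡ ∑ (suc e) (λ j → ℕtoℚ (e C j) * x ^ j)
  binomial-+1 x zero    = refl
  binomial-+1 x (suc e) = begin
    (x + 1ℚ) * (x + 1ℚ) ^ e                ≡⟨ cong ((x + 1ℚ) *_) (binomial-+1 x e) ⟩
    (x + 1ℚ) * ∑ (suc e) t                 ≡⟨ ℚP.*-distribʳ-+ (∑ (suc e) t) x 1ℚ ⟩
    x * ∑ (suc e) t + 1ℚ * ∑ (suc e) t     ≡⟨ cong₂ _+_ (*-distribˡ-∑ (suc e) x t) (ℚP.*-identityˡ _) ⟩
    ∑ (suc e) x*t + ∑ (suc e) t            ≡⟨ cong (_+_ (∑ (suc e) x*t)) (∑-unconsˡ e t) ⟩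
    ∑ (suc e) x*t + (1ℚ * 1ℚ + ∑ e t′)     ≡⟨ cong (λ r → ∑ (suc e) x*t + (1ℚ * 1ℚ + r)) t′-last ⟩
    ∑ (suc e) x*t + (1ℚ * 1ℚ + ∑ (suc e) t′)
      ≡⟨ rotate (∑ (suc e) x*t) (∑ (suc e) t′) ⟩
    1ℚ * 1ℚ + (∑ (suc e) x*t + ∑ (suc e) t′)
      ≡⟨ cong (_+_ (1ℚ * 1ℚ)) (trans (sym (∑-distrib-+ (suc e) x*t t′)) (∑-cong (suc e) (λ j _ → pascal j))) ⟩
    1ℚ * 1ℚ + ∑ (suc e) (λ j → ℕtoℚ (suc e C suc j) * x ^ suc j)
      ≡⟨ ∑-unconsˡ (suc e) (λ j → ℕtoℚ (suc e C j) * x ^ j) ⟨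
    ∑ (suc (suc e)) (λ j → ℕtoℚ (suc e C j) * x ^ j) ∎
    where
    open ≡-Reasoning
    t x*t t′ : ℕ → ℚ
    t j   = ℕtoℚ (e C j) * x ^ j
    x*t j = x * t j
    t′ j  = ℕtoℚ (e C suc j) * x ^ suc j
    t′-last : ∑ e t′ ≡ ∑ (suc e) t′
    t′-last = sym (trans (cong (_+_ (∑ e t′)) (trans (cong (λ c → ℕtoℚ c * x ^ suc e) (k>n⇒nCk≡0 (ℕP.n<1+n e)))
      (ℚP.*-zeroˡ (x ^ suc e)))) (ℚP.+-identityʳ (∑ e t′)))
    rotate : ∀ (a b : ℚ) → a + (1ℚ * 1ℚ + b) ≡ 1ℚ * 1ℚ + (a + b)
    rotate = solve-∀ ℚ-ring
    pascal : ∀ j → x*t j + t′ j ≡ ℕtoℚ (suc e C suc j) * x ^ suc j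
    pascal j = begin
      x * (ℕtoℚ (e C j) * x ^ j) + ℕtoℚ (e C suc j) * (x * x ^ j) ≡⟨ collect x (ℕtoℚ (e C j)) (ℕtoℚ (e C suc j)) (x ^ j) ⟩
      (ℕtoℚ (e C j) + ℕtoℚ (e C suc j)) * (x * x ^ j)             ≡⟨ cong (_* (x * x ^ j)) (ℕtoℚ-+ (e C j) (e C suc j)) ⟨
      ℕtoℚ (e C j ℕ.+ e C suc j) * (x * x ^ j)                    ≡⟨ cong (λ c → ℕtoℚ c * (x * x ^ j)) (nCk+nC[k+1]≡[n+1]C[k+1] e j) ⟩
      ℕtoℚ (suc e C suc j) * (x * x ^ j)                          ∎
      where
      collect : ∀ (x c d y : ℚ) → x * (c * y) + d * (x * y) ≡ (c + d) * (x * y)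
      collect = solve-∀ ℚ-ring

  binomial-+1-∸ : ∀ x e → (x + 1ℚ) ^ e - x ^ e ≡ ∑ e (λ j → ℕtoℚ (e C j) * x ^ j)
  binomial-+1-∸ x e = begin
    (x + 1ℚ) ^ e - x ^ e                     ≡⟨ cong (_- x ^ e) (binomial-+1 x e) ⟩
    ∑ e t + ℕtoℚ (e C e) * x ^ e - x ^ e     ≡⟨ cong (λ c → ∑ e t + ℕtoℚ c * x ^ e - x ^ e) (nCn≡1 e) ⟩
    ∑ e t + 1ℚ * x ^ e - x ^ e               ≡⟨ cancel (∑ e t) (x ^ e) ⟩
    ∑ e t                                    ∎
    where
    open ≡-Reasoning
    t = λ j → ℕtoℚ (e C j) * x ^ j
    cancel : ∀ (a b : ℚ) → a + 1ℚ * b - b ≡ a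
    cancel = solve-∀ ℚ-ring

  bernoulliList≡ : ∀ m → bernoulliList m ≡ applyUpTo bernoulli (suc m)
  bernoulli-suc≡next : ∀ m → bernoulli (suc m) ≡ nextBernoulli (suc m) (applyUpTo bernoulli (suc m))

  bernoulliList≡ zero    = refl
  bernoulliList≡ (suc m) = trans (cong (λ bs → bs ++ (nextBernoulli (suc m) bs ∷ [])) (bernoulliList≡ m))
    (trans (cong (applyUpTo bernoulli (suc m) ∷ʳ_) (sym (bernoulli-suc≡next m))) (applyUpTo-∷ʳ bernoulli (suc m)))

  bernoulli-suc≡next m = trans (cong (lastOr 0ℚ) (cong (λ bs → bs ++ (nextBernoulli (suc m) bs ∷ [])) (bernoulliList≡ m)))
    (lastOr-∷ʳ (applyUpTo bernoulli (suc m)))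
    where
    lastOr-∷ʳ : ∀ xs {y} → lastOr 0ℚ (xs ∷ʳ y) ≡ y
    lastOr-∷ʳ []           = refl
    lastOr-∷ʳ (x ∷ [])     = refl
    lastOr-∷ʳ (x ∷ w ∷ ws) = lastOr-∷ʳ (w ∷ ws)

  sumℚ-applyUpTo : ∀ (f : ℕ → ℚ) n → sumℚ (applyUpTo f n) ≡ ∑ n f
  sumℚ-applyUpTo f zero    = refl
  sumℚ-applyUpTo f (suc n) = trans (cong (_+_ (f 0)) (sumℚ-applyUpTo (λ k → f (suc k)) n)) (sym (∑-unconsˡ n f))

  zipWith-applyUpTo : ∀ (g : ℕ → ℚ → ℚ) (f : ℕ → ℕ) (h : ℕ → ℚ) n →
    zipWith g (applyUpTo f n) (applyUpTo h n) ≡ applyUpTo (λ k → g (f k) (h k)) n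
  zipWith-applyUpTo g f h zero    = refl
  zipWith-applyUpTo g f h (suc n) = cong (g (f 0) (h 0) ∷_) (zipWith-applyUpTo g (λ k → f (suc k)) (λ k → h (suc k)) n)

  δ₀ : ℕ → ℚ
  δ₀ zero    = 1ℚ
  δ₀ (suc _) = 0ℚ

  bernoulli-recurrence : ∀ m → ∑ (suc m) (λ k → ℕtoℚ (suc m C k) * bernoulli k) ≡ δ₀ m
  bernoulli-recurrence zero    = refl
  bernoulli-recurrence (suc m) = begin
    S + ℕtoℚ (suc (suc m) C suc m) * bernoulli (suc m)  ≡⟨ cong₂ (λ c b → S + ℕtoℚ c * b) ([1+n]Cn≡1+n (suc m)) B[m+1]≡ ⟩
    S + ℕtoℚ (suc (suc m)) * - (1/ suc (suc m) * S)    ≡⟨ rearrange S (ℕtoℚ (suc (suc m))) (1/ suc (suc m)) ⟩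
    S - (ℕtoℚ (suc (suc m)) * 1/ suc (suc m)) * S      ≡⟨ cong (λ t → S - t * S) (*-1/ (suc (suc m))) ⟩
    S - 1ℚ * S                                          ≡⟨ cancel S ⟩
    0ℚ                                                  ∎
    where
    open ≡-Reasoning
    S = ∑ (suc m) (λ k → ℕtoℚ (suc (suc m) C k) * bernoulli k)
    B[m+1]≡ : bernoulli (suc m) ≡ - (1/ suc (suc m) * S)
    B[m+1]≡ = trans (bernoulli-suc≡next m) (cong (λ t → - (1/ suc (suc m) * t))
      (trans (cong sumℚ (zipWith-applyUpTo (λ k b → ℕtoℚ (suc (suc m) C k) * b) (λ k → k) bernoulli (suc m)))
        (sumℚ-applyUpTo (λ k → ℕtoℚ (suc (suc m) C k) * bernoulli k) (suc m))))
    rearrange : ∀ (s n i : ℚ) → s + n * - (i * s) ≡ s - (n * i) * s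
    rearrange = solve-∀ ℚ-ring
    cancel : ∀ (s : ℚ) → s - 1ℚ * s ≡ 0ℚ
    cancel = solve-∀ ℚ-ring

  bernoulli-recurrence-∸ : ∀ m j → j ≤ m → ∑ (suc m ∸ j) (λ k → ℕtoℚ ((suc m ∸ j) C k) * bernoulli k) ≡ δ₀ (m ∸ j)
  bernoulli-recurrence-∸ m j j≤m rewrite ℕP.+-∸-assoc 1 j≤m = bernoulli-recurrence (m ∸ j)

  ∑-δ₀ : ∀ m (d : ℕ → ℚ) → ∑ (suc m) (λ j → d j * δ₀ (m ∸ j)) ≡ d m
  ∑-δ₀ m d = begin
    ∑ m (λ j → d j * δ₀ (m ∸ j)) + d m * δ₀ (m ∸ m)
      ≡⟨ cong₂ _+_ (trans (∑-cong m off-diagonal) (∑-zero m)) (cong (λ t → d m * δ₀ t) (ℕP.n∸n≡0 m)) ⟩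
    0ℚ + d m * 1ℚ
      ≡⟨ trans (ℚP.+-identityˡ (d m * 1ℚ)) (ℚP.*-identityʳ (d m)) ⟩
    d m ∎
    where
    open ≡-Reasoning
    off-diagonal : ∀ j → j < m → d j * δ₀ (m ∸ j) ≡ 0ℚ
    off-diagonal j j<m rewrite ℕP.+-∸-assoc 1 j<m = ℚP.*-zeroʳ (d j)

  faulhaberPolynomial : ℕ → ℚ → ℚ
  faulhaberPolynomial m y = ∑ (suc m) (λ k → ℕtoℚ (suc m C k) * bernoulli k * y ^ (suc m ∸ k))

  faulhaberPolynomial-step : ∀ m y → faulhaberPolynomial m (y + 1ℚ) - faulhaberPolynomial m y ≡ ℕtoℚ (suc m) * y ^ m
  faulhaberPolynomial-step m y = begin
    ∑ M (λ k → c k * (y + 1ℚ) ^ (M ∸ k)) - ∑ M (λ k → c k * y ^ (M ∸ k))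
      ≡⟨ ∑-distrib-- M (λ k → c k * (y + 1ℚ) ^ (M ∸ k)) (λ k → c k * y ^ (M ∸ k)) ⟨
    ∑ M (λ k → c k * (y + 1ℚ) ^ (M ∸ k) - c k * y ^ (M ∸ k))
      ≡⟨ ∑-cong M (λ k _ → trans (factor (c k) _ _) (cong (c k *_) (binomial-+1-∸ y (M ∸ k)))) ⟩
    ∑ M (λ k → c k * ∑ (M ∸ k) (λ j → ℕtoℚ ((M ∸ k) C j) * y ^ j))
      ≡⟨ ∑-cong M (λ k _ → *-distribˡ-∑ (M ∸ k) (c k) _) ⟩
    ∑ M (λ k → ∑ (M ∸ k) (λ j → c k * (ℕtoℚ ((M ∸ k) C j) * y ^ j)))
      ≡⟨ ∑-comm-triangle M _ ⟩
    ∑ M (λ j → ∑ (M ∸ j) (λ k → c k * (ℕtoℚ ((M ∸ k) C j) * y ^ j)))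
      ≡⟨ ∑-cong M (λ j j<M → ∑-cong (M ∸ j) (λ k → regroup j k (ℕP.≤-pred j<M))) ⟩
    ∑ M (λ j → ∑ (M ∸ j) (λ k → d j * (ℕtoℚ ((M ∸ j) C k) * bernoulli k)))
      ≡⟨ ∑-cong M (λ j j<M → trans (sym (*-distribˡ-∑ (M ∸ j) (d j) _)) (cong (d j *_) (bernoulli-recurrence-∸ m j (ℕP.≤-pred j<M)))) ⟩
    ∑ M (λ j → d j * δ₀ (m ∸ j))
      ≡⟨ ∑-δ₀ m d ⟩
    d m
      ≡⟨ cong (λ t → ℕtoℚ t * y ^ m) ([1+n]Cn≡1+n m) ⟩
    ℕtoℚ (suc m) * y ^ m ∎
    where
    open ≡-Reasoning
    M = suc m
    c d : ℕ → ℚ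
    c k = ℕtoℚ (M C k) * bernoulli k
    d j = ℕtoℚ (M C j) * y ^ j
    factor : ∀ (a b e : ℚ) → a * b - a * e ≡ a * (b - e)
    factor = solve-∀ ℚ-ring
    regroup : ∀ j k → j ≤ m → k < M ∸ j → c k * (ℕtoℚ ((M ∸ k) C j) * y ^ j) ≡ d j * (ℕtoℚ ((M ∸ j) C k) * bernoulli k)
    regroup j k j≤m k<M-j = begin
      (ℕtoℚ (M C k) * bernoulli k) * (ℕtoℚ ((M ∸ k) C j) * y ^ j)   ≡⟨ swap (ℕtoℚ (M C k)) (bernoulli k) (ℕtoℚ ((M ∸ k) C j)) (y ^ j) ⟩
      (ℕtoℚ (M C k) * ℕtoℚ ((M ∸ k) C j)) * (bernoulli k * y ^ j)   ≡⟨ cong (_* (bernoulli k * y ^ j)) binomials ⟩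
      (ℕtoℚ (M C j) * ℕtoℚ ((M ∸ j) C k)) * (bernoulli k * y ^ j)   ≡⟨ swap′ (ℕtoℚ (M C j)) (ℕtoℚ ((M ∸ j) C k)) (bernoulli k) (y ^ j) ⟩
      (ℕtoℚ (M C j) * y ^ j) * (ℕtoℚ ((M ∸ j) C k) * bernoulli k)   ∎
      where
      swap : ∀ (a b c e : ℚ) → (a * b) * (c * e) ≡ (a * c) * (b * e)
      swap = solve-∀ ℚ-ring
      swap′ : ∀ (a b c e : ℚ) → (a * b) * (c * e) ≡ (a * e) * (b * c)
      swap′ = solve-∀ ℚ-ring
      binomials : ℕtoℚ (M C k) * ℕtoℚ ((M ∸ k) C j) ≡ ℕtoℚ (M C j) * ℕtoℚ ((M ∸ j) C k)
      binomials = trans (sym (ℕtoℚ-* (M C k) ((M ∸ k) C j))) (trans (cong ℕtoℚ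
        (nCk*[n∸k]Cj≡nCj*[n∸j]Ck M k j (ℕP.m≤o∸n⇒m+n≤o k (ℕP.m≤n⇒m≤1+n j≤m) (ℕP.<⇒≤ k<M-j))))
        (ℕtoℚ-* (M C j) ((M ∸ j) C k)))

  powerSum : ℕ → ℕ → ℚ
  powerSum m N = ∑ N (λ b → ℕtoℚ b ^ m)

  [1+m]*powerSum≡faulhaberPolynomial : ∀ m N → ℕtoℚ (suc m) * powerSum m N ≡ faulhaberPolynomial m (ℕtoℚ N)
  [1+m]*powerSum≡faulhaberPolynomial m zero = trans (ℚP.*-zeroʳ (ℕtoℚ (suc m)))
    (sym (trans (∑-cong (suc m) vanishes) (∑-zero (suc m))))
    where
    vanishes : ∀ k → k < suc m → ℕtoℚ (suc m C k) * bernoulli k * 0ℚ ^ (suc m ∸ k) ≡ 0ℚ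
    vanishes k k<1+m = trans (cong (ℕtoℚ (suc m C k) * bernoulli k *_) (0^-positive (suc m ∸ k) (ℕP.m<n⇒0<n∸m k<1+m)))
      (ℚP.*-zeroʳ (ℕtoℚ (suc m C k) * bernoulli k))
  [1+m]*powerSum≡faulhaberPolynomial m (suc N) = begin
    ℕtoℚ (suc m) * (powerSum m N + ℕtoℚ N ^ m)
      ≡⟨ ℚP.*-distribˡ-+ (ℕtoℚ (suc m)) (powerSum m N) (ℕtoℚ N ^ m) ⟩
    ℕtoℚ (suc m) * powerSum m N + ℕtoℚ (suc m) * ℕtoℚ N ^ m
      ≡⟨ cong₂ _+_ ([1+m]*powerSum≡faulhaberPolynomial m N) (sym (faulhaberPolynomial-step m (ℕtoℚ N))) ⟩
    F (ℕtoℚ N) + (F (ℕtoℚ N + 1ℚ) - F (ℕtoℚ N))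
      ≡⟨ cancel (F (ℕtoℚ N)) (F (ℕtoℚ N + 1ℚ)) ⟩
    F (ℕtoℚ N + 1ℚ)
      ≡⟨ cong F (ℕtoℚ-suc N) ⟨
    F (ℕtoℚ (suc N)) ∎
    where
    open ≡-Reasoning
    F = faulhaberPolynomial m
    cancel : ∀ (a b : ℚ) → a + (b - a) ≡ b
    cancel = solve-∀ ℚ-ring

  -- 1/n, with the junk value 0 at n = 0
  recip : ℕ → ℚ
  recip zero    = 0ℚ
  recip (suc n) = 1/ suc n

  1/[1+m]*[1+m]Ck≡mCk*recip[1+m∸k] : ∀ m k → k ≤ m → 1/ suc m * ℕtoℚ (suc m C k) ≡ ℕtoℚ (m C k) * recip (suc m ∸ k)
  1/[1+m]*[1+m]Ck≡mCk*recip[1+m∸k] m k k≤m =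
    trans main (cong (λ t → ℕtoℚ (m C k) * recip t) (sym (ℕP.+-∸-assoc 1 k≤m)))
    where
    open ≡-Reasoning
    i₁ = 1/ suc m
    i₂ = 1/ suc (m ∸ k)
    n = ℕtoℚ (suc (m ∸ k))
    X = ℕtoℚ (suc m C k)
    Y = ℕtoℚ (m C k)
    absorb : n * X ≡ ℕtoℚ (suc m) * Y
    absorb = trans (sym (ℕtoℚ-* (suc (m ∸ k)) (suc m C k))) (trans (cong ℕtoℚ
      (trans (cong (ℕ._* (suc m C k)) (sym (ℕP.+-∸-assoc 1 k≤m))) ([1+m∸k]*[1+m]Ck≡[1+m]*mCk m k k≤m)))
      (ℕtoℚ-* (suc m) (m C k)))
    expand : ∀ (a x n b : ℚ) → a * x ≡ a * (n * x) * b + a * x * (1ℚ - n * b)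
    expand = solve-∀ ℚ-ring
    collapse : ∀ (a n y b x : ℚ) → a * (n * y) * b + a * x * (1ℚ - 1ℚ) ≡ (n * a) * y * b
    collapse = solve-∀ ℚ-ring
    main : i₁ * X ≡ Y * i₂
    main = begin
      i₁ * X                                                    ≡⟨ expand i₁ X n i₂ ⟩
      i₁ * (n * X) * i₂ + i₁ * X * (1ℚ - n * i₂)                ≡⟨ cong₂ (λ s t → i₁ * s * i₂ + i₁ * X * (1ℚ - t)) absorb (*-1/ (suc (m ∸ k))) ⟩
      i₁ * (ℕtoℚ (suc m) * Y) * i₂ + i₁ * X * (1ℚ - 1ℚ)        ≡⟨ collapse i₁ (ℕtoℚ (suc m)) Y i₂ X ⟩
      (ℕtoℚ (suc m) * i₁) * Y * i₂                              ≡⟨ cong (λ t → t * Y * i₂) (*-1/ (suc m)) ⟩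
      1ℚ * Y * i₂                                               ≡⟨ cong (_* i₂) (ℚP.*-identityˡ Y) ⟩
      Y * i₂                                                    ∎

  faulhaber : ∀ m N → powerSum m N ≡
    ∑ (suc m) (λ k → ℕtoℚ (m C k) * bernoulli k * (ℕtoℚ N ^ (suc m ∸ k) * recip (suc m ∸ k)))
  faulhaber m N = begin
    powerSum m N                                   ≡⟨ 1/-* (suc m) (powerSum m N) ⟨
    1/ suc m * (ℕtoℚ (suc m) * powerSum m N)       ≡⟨ cong (1/ suc m *_) ([1+m]*powerSum≡faulhaberPolynomial m N) ⟩
    1/ suc m * faulhaberPolynomial m (ℕtoℚ N)      ≡⟨ *-distribˡ-∑ (suc m) (1/ suc m) _ ⟩
    ∑ (suc m) (λ k → 1/ suc m * (ℕtoℚ (suc m C k) * bernoulli k * ℕtoℚ N ^ (suc m ∸ k)))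
      ≡⟨ ∑-cong (suc m) (λ k k<1+m → term k (ℕP.≤-pred k<1+m)) ⟩
    ∑ (suc m) (λ k → ℕtoℚ (m C k) * bernoulli k * (ℕtoℚ N ^ (suc m ∸ k) * recip (suc m ∸ k))) ∎
    where
    open ≡-Reasoning
    term : ∀ k → k ≤ m → 1/ suc m * (ℕtoℚ (suc m C k) * bernoulli k * ℕtoℚ N ^ (suc m ∸ k))
                       ≡ ℕtoℚ (m C k) * bernoulli k * (ℕtoℚ N ^ (suc m ∸ k) * recip (suc m ∸ k))
    term k k≤m = trans (assoc₁ (1/ suc m) (ℕtoℚ (suc m C k)) (bernoulli k) (ℕtoℚ N ^ (suc m ∸ k)))
      (trans (cong (λ s → s * (bernoulli k * ℕtoℚ N ^ (suc m ∸ k))) (1/[1+m]*[1+m]Ck≡mCk*recip[1+m∸k] m k k≤m))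
        (assoc₂ (ℕtoℚ (m C k)) (recip (suc m ∸ k)) (bernoulli k) (ℕtoℚ N ^ (suc m ∸ k))))
      where
      assoc₁ : ∀ (a b c d : ℚ) → a * (b * c * d) ≡ (a * b) * (c * d)
      assoc₁ = solve-∀ ℚ-ring
      assoc₂ : ∀ (a b c d : ℚ) → (a * b) * (c * d) ≡ a * c * (d * b)
      assoc₂ = solve-∀ ℚ-ring

  ∑-binomial-powerSum : ∀ k N → ∑ (suc k) (λ j → ℕtoℚ (suc k C j) * powerSum j N) ≡ ℕtoℚ N ^ suc k
  ∑-binomial-powerSum k N = begin
    ∑ K (λ j → ℕtoℚ (K C j) * powerSum j N)             ≡⟨ ∑-cong K (λ j _ → *-distribˡ-∑ N (ℕtoℚ (K C j)) (λ b → ℕtoℚ b ^ j)) ⟩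
    ∑ K (λ j → ∑ N (λ b → ℕtoℚ (K C j) * ℕtoℚ b ^ j))   ≡⟨ ∑-comm K N _ ⟩
    ∑ N (λ b → ∑ K (λ j → ℕtoℚ (K C j) * ℕtoℚ b ^ j))   ≡⟨ ∑-cong N (λ b _ → trans (sym (binomial-+1-∸ (ℕtoℚ b) K))
                                                              (cong (λ t → t ^ K - ℕtoℚ b ^ K) (sym (ℕtoℚ-suc b)))) ⟩
    ∑ N (λ b → ℕtoℚ (suc b) ^ K - ℕtoℚ b ^ K)           ≡⟨ ∑-telescope N (λ b → ℕtoℚ b ^ K) ⟩
    ℕtoℚ N ^ K - 0ℚ ^ K                                  ≡⟨ cong (_-_ (ℕtoℚ N ^ K)) (0^-positive K (s≤s z≤n)) ⟩
    ℕtoℚ N ^ K - 0ℚ                                      ≡⟨ ℚP.+-identityʳ (ℕtoℚ N ^ K) ⟩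
    ℕtoℚ N ^ K                                           ∎
    where
    open ≡-Reasoning
    K = suc k

  -- Divisibility by powers of a prime p in ℚ

  module _ (p : ℕ) .{{_ : NonZero p}} (p-prime : Prime p) where

    p∤1 : ¬ p ∣ 1
    p∤1 p∣1 = ¬prime[1] (subst Prime (∣1⇒≡1 p∣1) p-prime)

    p∤-* : ∀ {a b} → ¬ p ∣ a → ¬ p ∣ b → ¬ p ∣ (a ℕ.* b)
    p∤-* {a} {b} p∤a p∤b p∣ab with euclidsLemma a b p-prime p∣ab
    ... | inj₁ p∣a = p∤a p∣a
    ... | inj₂ p∣b = p∤b p∣b

    p-1<p : p ∸ 1 < p
    p-1<p = ℕP.≤-reflexive (ℕP.suc-pred p)

    p∤-< : ∀ {m} → 0 < m → m < p → ¬ p ∣ m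
    p∤-< {suc m} _ m<p p∣m = ℕP.<⇒≱ m<p (∣⇒≤ p∣m)

    record p^_∣_ (k : ℕ) (x : ℚ) : Set where
      constructor divides-by
      field
        numerator     : ℤ
        denominator   : ℕ
        p∤denominator : ¬ p ∣ denominator
        equation      : x * ℕtoℚ denominator ≡ (numerator ℤ.* + (p ℕ.^ k)) ℚ./ 1

    p^∣⇒CongQ : ∀ {k x y} → p^ k ∣ (x - y) → CongQ p k x y
    p^∣⇒CongQ (divides-by u v p∤v eq) = u , v , p∤v , eq

    p^∣-intro : ∀ {k x} u v → ¬ p ∣ v → x * ℕtoℚ v ≡ ℤtoℚ u * ℕtoℚ (p ℕ.^ k) → p^ k ∣ x
    p^∣-intro {k} u v p∤v eq = divides-by u v p∤v (trans eq (sym (ℤtoℚ-* u (+ (p ℕ.^ k)))))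

    p^∣-equation : ∀ {k x} (d : p^ k ∣ x) →
      x * ℕtoℚ (p^_∣_.denominator d) ≡ ℤtoℚ (p^_∣_.numerator d) * ℕtoℚ (p ℕ.^ k)
    p^∣-equation {k} (divides-by u v _ eq) = trans eq (ℤtoℚ-* u (+ (p ℕ.^ k)))

    p^∣0 : ∀ {k} → p^ k ∣ 0ℚ
    p^∣0 {k} = p^∣-intro (+ 0) 1 p∤1 (trans (ℚP.*-zeroˡ 1ℚ) (sym (ℚP.*-zeroˡ (ℕtoℚ (p ℕ.^ k)))))

    p^0∣ℕ : ∀ n → p^ 0 ∣ ℕtoℚ n
    p^0∣ℕ n = p^∣-intro (+ n) 1 p∤1 refl

    p^0∣1/ : ∀ m .{{_ : NonZero m}} → ¬ p ∣ m → p^ 0 ∣ 1/ m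
    p^0∣1/ m p∤m = p^∣-intro (+ 1) m p∤m (trans (ℚP.*-comm (1/ m) (ℕtoℚ m)) (*-1/ m))

    p^k∣p^k : ∀ k → p^ k ∣ (ℕtoℚ p ^ k)
    p^k∣p^k k = subst (p^ k ∣_) (ℕtoℚ-^ p k)
      (p^∣-intro (+ 1) 1 p∤1 (trans (ℚP.*-identityʳ (ℕtoℚ (p ℕ.^ k))) (sym (ℚP.*-identityˡ (ℕtoℚ (p ℕ.^ k))))))

    p^1∣p : p^ 1 ∣ ℕtoℚ p
    p^1∣p = subst (p^ 1 ∣_) (ℚP.*-identityʳ (ℕtoℚ p)) (p^k∣p^k 1)

    p^∣-+ : ∀ {k x y} → p^ k ∣ x → p^ k ∣ y → p^ k ∣ (x + y)
    p^∣-+ {k} {x} {y} dx@(divides-by u₁ v₁ p∤v₁ _) dy@(divides-by u₂ v₂ p∤v₂ _) =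
      p^∣-intro (u₁ ℤ.* + v₂ ℤ.+ u₂ ℤ.* + v₁) (v₁ ℕ.* v₂) (p∤-* p∤v₁ p∤v₂) (begin
        (x + y) * ℕtoℚ (v₁ ℕ.* v₂)                         ≡⟨ cong ((x + y) *_) (ℕtoℚ-* v₁ v₂) ⟩
        (x + y) * (ℕtoℚ v₁ * ℕtoℚ v₂)                      ≡⟨ expand x y (ℕtoℚ v₁) (ℕtoℚ v₂) ⟩
        (x * ℕtoℚ v₁) * ℕtoℚ v₂ + (y * ℕtoℚ v₂) * ℕtoℚ v₁ ≡⟨ cong₂ (λ a b → a * ℕtoℚ v₂ + b * ℕtoℚ v₁) (p^∣-equation dx) (p^∣-equation dy) ⟩
        (ℤtoℚ u₁ * P) * ℕtoℚ v₂ + (ℤtoℚ u₂ * P) * ℕtoℚ v₁ ≡⟨ collect (ℤtoℚ u₁) (ℤtoℚ u₂) P (ℕtoℚ v₁) (ℕtoℚ v₂) ⟩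
        (ℤtoℚ u₁ * ℤtoℚ (+ v₂) + ℤtoℚ u₂ * ℤtoℚ (+ v₁)) * P
          ≡⟨ cong (_* P) (trans (ℤtoℚ-+ (u₁ ℤ.* + v₂) (u₂ ℤ.* + v₁)) (cong₂ _+_ (ℤtoℚ-* u₁ (+ v₂)) (ℤtoℚ-* u₂ (+ v₁)))) ⟨
        ℤtoℚ (u₁ ℤ.* + v₂ ℤ.+ u₂ ℤ.* + v₁) * P             ∎)
      where
      open ≡-Reasoning
      P = ℕtoℚ (p ℕ.^ k)
      expand : ∀ (a b c d : ℚ) → (a + b) * (c * d) ≡ (a * c) * d + (b * d) * c
      expand = solve-∀ ℚ-ring
      collect : ∀ (a b c d e : ℚ) → (a * c) * e + (b * c) * d ≡ (a * e + b * d) * c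
      collect = solve-∀ ℚ-ring

    p^∣-neg : ∀ {k x} → p^ k ∣ x → p^ k ∣ (- x)
    p^∣-neg {k} {x} dx@(divides-by u v p∤v _) = p^∣-intro (ℤ.- u) v p∤v (begin
      (- x) * ℕtoℚ v   ≡⟨ ℚP.neg-distribˡ-* x (ℕtoℚ v) ⟨
      - (x * ℕtoℚ v)   ≡⟨ cong -_ (p^∣-equation dx) ⟩
      - (ℤtoℚ u * P)   ≡⟨ ℚP.neg-distribˡ-* (ℤtoℚ u) P ⟩
      (- ℤtoℚ u) * P   ≡⟨ cong (_* P) (ℤtoℚ-neg u) ⟨
      ℤtoℚ (ℤ.- u) * P ∎)
      where
      open ≡-Reasoning
      P = ℕtoℚ (p ℕ.^ k)

    p^∣-- : ∀ {k x y} → p^ k ∣ x → p^ k ∣ y → p^ k ∣ (x - y)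
    p^∣-- dx dy = p^∣-+ dx (p^∣-neg dy)

    p^∣-* : ∀ {j k x y} → p^ j ∣ x → p^ k ∣ y → p^ (j ℕ.+ k) ∣ (x * y)
    p^∣-* {j} {k} {x} {y} dx@(divides-by u₁ v₁ p∤v₁ _) dy@(divides-by u₂ v₂ p∤v₂ _) =
      p^∣-intro (u₁ ℤ.* u₂) (v₁ ℕ.* v₂) (p∤-* p∤v₁ p∤v₂) (begin
        (x * y) * ℕtoℚ (v₁ ℕ.* v₂)          ≡⟨ cong ((x * y) *_) (ℕtoℚ-* v₁ v₂) ⟩
        (x * y) * (ℕtoℚ v₁ * ℕtoℚ v₂)       ≡⟨ interchange x y (ℕtoℚ v₁) (ℕtoℚ v₂) ⟩
        (x * ℕtoℚ v₁) * (y * ℕtoℚ v₂)       ≡⟨ cong₂ _*_ (p^∣-equation dx) (p^∣-equation dy) ⟩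
        (ℤtoℚ u₁ * P j) * (ℤtoℚ u₂ * P k)   ≡⟨ interchange (ℤtoℚ u₁) (P j) (ℤtoℚ u₂) (P k) ⟩
        (ℤtoℚ u₁ * ℤtoℚ u₂) * (P j * P k)   ≡⟨ cong₂ _*_ (sym (ℤtoℚ-* u₁ u₂)) P-+ ⟩
        ℤtoℚ (u₁ ℤ.* u₂) * P (j ℕ.+ k)      ∎)
      where
      open ≡-Reasoning
      P : ℕ → ℚ
      P i = ℕtoℚ (p ℕ.^ i)
      P-+ : P j * P k ≡ P (j ℕ.+ k)
      P-+ = sym (trans (cong ℕtoℚ (ℕP.^-distribˡ-+-* p j k)) (ℕtoℚ-* (p ℕ.^ j) (p ℕ.^ k)))
      interchange : ∀ (a b c d : ℚ) → (a * b) * (c * d) ≡ (a * c) * (b * d)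
      interchange = solve-∀ ℚ-ring

    p^∣-*ˡ : ∀ {k x y} → p^ 0 ∣ x → p^ k ∣ y → p^ k ∣ (x * y)
    p^∣-*ˡ = p^∣-*

    p^∣-*ʳ : ∀ {k x y} → p^ k ∣ x → p^ 0 ∣ y → p^ k ∣ (x * y)
    p^∣-*ʳ {k} dx dy = subst (p^_∣ _) (ℕP.+-identityʳ k) (p^∣-* dx dy)

    p^0∣-^ : ∀ {x} n → p^ 0 ∣ x → p^ 0 ∣ (x ^ n)
    p^0∣-^ zero    dx = p^0∣ℕ 1
    p^0∣-^ (suc n) dx = p^∣-*ˡ dx (p^0∣-^ n dx)

    p^∣-∑ : ∀ {k} n (f : ℕ → ℚ) → (∀ i → i < n → p^ k ∣ f i) → p^ k ∣ ∑ n f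
    p^∣-∑ zero    f df = p^∣0
    p^∣-∑ (suc n) f df = p^∣-+ (p^∣-∑ n f (λ i i<n → df i (ℕP.m<n⇒m<1+n i<n))) (df n (ℕP.n<1+n n))

    p^∣-weaken-suc : ∀ {k x} → p^ suc k ∣ x → p^ k ∣ x
    p^∣-weaken-suc {k} {x} dx@(divides-by u v p∤v _) = p^∣-intro (u ℤ.* + p) v p∤v (begin
      x * ℕtoℚ v                      ≡⟨ p^∣-equation dx ⟩
      ℤtoℚ u * ℕtoℚ (p ℕ.^ suc k)     ≡⟨ cong (ℤtoℚ u *_) (ℕtoℚ-* p (p ℕ.^ k)) ⟩
      ℤtoℚ u * (ℕtoℚ p * P)           ≡⟨ ℚP.*-assoc (ℤtoℚ u) (ℕtoℚ p) P ⟨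
      (ℤtoℚ u * ℕtoℚ p) * P           ≡⟨ cong (_* P) (ℤtoℚ-* u (+ p)) ⟨
      ℤtoℚ (u ℤ.* + p) * P            ∎)
      where
      open ≡-Reasoning
      P = ℕtoℚ (p ℕ.^ k)

    p^∣-weaken : ∀ {j k x} → j ≤ k → p^ k ∣ x → p^ j ∣ x
    p^∣-weaken {k = zero} z≤n dx = dx
    p^∣-weaken {k = suc k} j≤1+k dx with ℕP.m≤n⇒m<n∨m≡n j≤1+k
    ... | inj₁ (s≤s j≤k) = p^∣-weaken j≤k (p^∣-weaken-suc dx)
    ... | inj₂ refl      = dx

    p^∣-cancel-p : ∀ {k x} → p^ suc k ∣ (ℕtoℚ p * x) → p^ k ∣ x
    p^∣-cancel-p {k} {x} dpx@(divides-by u v p∤v _) = p^∣-intro u v p∤v (begin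
      x * ℕtoℚ v                       ≡⟨ 1/-* p (x * ℕtoℚ v) ⟨
      1/ p * (ℕtoℚ p * (x * ℕtoℚ v))   ≡⟨ cong (1/ p *_) (ℚP.*-assoc (ℕtoℚ p) x (ℕtoℚ v)) ⟨
      1/ p * ((ℕtoℚ p * x) * ℕtoℚ v)   ≡⟨ cong (1/ p *_) (p^∣-equation dpx) ⟩
      1/ p * (ℤtoℚ u * ℕtoℚ (p ℕ.^ suc k)) ≡⟨ cong (λ t → 1/ p * (ℤtoℚ u * t)) (ℕtoℚ-* p (p ℕ.^ k)) ⟩
      1/ p * (ℤtoℚ u * (ℕtoℚ p * P))   ≡⟨ cong (1/ p *_) (swap (ℤtoℚ u) (ℕtoℚ p) P) ⟩
      1/ p * (ℕtoℚ p * (ℤtoℚ u * P))   ≡⟨ 1/-* p (ℤtoℚ u * P) ⟩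
      ℤtoℚ u * P                       ∎)
      where
      open ≡-Reasoning
      P = ℕtoℚ (p ℕ.^ k)
      swap : ∀ (a b c : ℚ) → a * (b * c) ≡ b * (a * c)
      swap = solve-∀ ℚ-ring

    p^1∣[a-a%p] : ∀ a → p^ 1 ∣ (ℕtoℚ a - ℕtoℚ (a % p))
    p^1∣[a-a%p] a = subst (p^ 1 ∣_) (sym a-a%p≡) (p^∣-*ʳ p^1∣p (p^0∣ℕ (a / p)))
      where
      a-a%p≡ : ℕtoℚ a - ℕtoℚ (a % p) ≡ ℕtoℚ p * ℕtoℚ (a / p)
      a-a%p≡ = trans (cong (_- ℕtoℚ (a % p)) (ℕtoℚ-divMod a p)) (cancel (ℕtoℚ (a % p)) _)
        where
        cancel : ∀ (r q : ℚ) → (r + q) - r ≡ q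
        cancel = solve-∀ ℚ-ring

    1<p : 1 < p
    1<p = nonTrivial⇒n>1 p {{prime⇒nonTrivial p-prime}}

    p-adic-decomposition : ∀ m → 0 < m → ∃₂ λ v w → m ≡ p ℕ.^ v ℕ.* w × ¬ p ∣ w
    p-adic-decomposition = <-rec (λ m → 0 < m → ∃₂ λ v w → m ≡ p ℕ.^ v ℕ.* w × ¬ p ∣ w) decompose
      where
      decompose : ∀ m → (∀ {n} → n < m → 0 < n → ∃₂ λ v w → n ≡ p ℕ.^ v ℕ.* w × ¬ p ∣ w) →
        0 < m → ∃₂ λ v w → m ≡ p ℕ.^ v ℕ.* w × ¬ p ∣ w
      decompose m rec 0<m with p ∣? m
      ... | no p∤m = 0 , m , sym (ℕP.+-identityʳ m) , p∤m
      ... | yes (divides q m≡q*p) with rec q<m 0<q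
        where
        0<q : 0 < q
        0<q = ℕP.n≢0⇒n>0 (λ { refl → ℕP.<⇒≢ 0<m (sym m≡q*p) })
        q<m : q < m
        q<m = subst (q <_) (sym m≡q*p) (ℕP.m<m*n q p {{ℕ.>-nonZero 0<q}} 1<p)
      ... | v , w , q≡ , p∤w = suc v , w , trans m≡q*p (trans (cong (ℕ._* p) q≡) (reorder (p ℕ.^ v) w p)) , p∤w
        where
        reorder : ∀ a b c → a ℕ.* b ℕ.* c ≡ c ℕ.* a ℕ.* b
        reorder a b c = trans (ℕP.*-comm (a ℕ.* b) c) (sym (ℕP.*-assoc c a b))

    p^∣-p^n*recip : ∀ {c n m} v w → m ≡ p ℕ.^ v ℕ.* w → ¬ p ∣ w → c ℕ.+ v ≤ n →
      p^ c ∣ (ℕtoℚ p ^ n * recip m)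
    p^∣-p^n*recip {c} {n} {zero}   _ _ _  _   _     = subst (p^ c ∣_) (sym (ℚP.*-zeroʳ (ℕtoℚ p ^ n))) p^∣0
    p^∣-p^n*recip {c} {n} {suc m′} v w m≡ p∤w c+v≤n =
      subst (p^ c ∣_) (sym split) (p^∣-*ʳ (p^∣-weaken c≤n∸v (p^k∣p^k (n ∸ v))) (p^0∣1/ w p∤w))
      where
      open ≡-Reasoning
      m = suc m′
      instance
        w≢0 : NonZero w
      w≢0 = ℕ.≢-nonZero (λ { refl → ℕP.1+n≢0 (trans m≡ (ℕP.*-zeroʳ (p ℕ.^ v))) })
      c≤n∸v : c ≤ n ∸ v
      c≤n∸v = ℕP.m+n≤o⇒m≤o∸n c c+v≤n
      v≤n : v ≤ n
      v≤n = ℕP.≤-trans (ℕP.m≤n+m v c) c+v≤n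
      p^v*1/m≡1/w : ℕtoℚ p ^ v * 1/ m ≡ 1/ w
      p^v*1/m≡1/w = begin
        ℕtoℚ p ^ v * 1/ m                                ≡⟨ 1/-* w _ ⟨
        1/ w * (ℕtoℚ w * (ℕtoℚ p ^ v * 1/ m))    ≡⟨ cong (1/ w *_) (trans (sym (ℚP.*-assoc (ℕtoℚ w) (ℕtoℚ p ^ v) (1/ m)))
                                                              (cong (_* 1/ m) (trans (ℚP.*-comm (ℕtoℚ w) _) w*p^v≡m))) ⟩
        1/ w * (ℕtoℚ m * 1/ m)                   ≡⟨ cong (1/ w *_) (*-1/ m) ⟩
        1/ w * 1ℚ                                ≡⟨ ℚP.*-identityʳ _ ⟩
        1/ w                                     ∎
        where
        w*p^v≡m : ℕtoℚ p ^ v * ℕtoℚ w ≡ ℕtoℚ m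
        w*p^v≡m = trans (cong (_* ℕtoℚ w) (sym (ℕtoℚ-^ p v))) (trans (sym (ℕtoℚ-* (p ℕ.^ v) w)) (cong ℕtoℚ (sym m≡)))
      split : ℕtoℚ p ^ n * recip m ≡ ℕtoℚ p ^ (n ∸ v) * 1/ w
      split = begin
        ℕtoℚ p ^ n * 1/ m                         ≡⟨ cong (λ e → ℕtoℚ p ^ e * 1/ m) (ℕP.m∸n+n≡m v≤n) ⟨
        ℕtoℚ p ^ (n ∸ v ℕ.+ v) * 1/ m             ≡⟨ cong (_* 1/ m) (^-homo-* (ℕtoℚ p) (n ∸ v) v) ⟩
        ℕtoℚ p ^ (n ∸ v) * ℕtoℚ p ^ v * 1/ m      ≡⟨ ℚP.*-assoc (ℕtoℚ p ^ (n ∸ v)) (ℕtoℚ p ^ v) (1/ m) ⟩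
        ℕtoℚ p ^ (n ∸ v) * (ℕtoℚ p ^ v * 1/ m)    ≡⟨ cong (ℕtoℚ p ^ (n ∸ v) *_) p^v*1/m≡1/w ⟩
        ℕtoℚ p ^ (n ∸ v) * 1/ w           ∎

    -- Residues modulo p and Fermat's little theorem

    p∣-<⇒≡0 : ∀ {n} → n < p → p ∣ n → n ≡ 0
    p∣-<⇒≡0 {zero}  _   _   = refl
    p∣-<⇒≡0 {suc n} n<p p∣n = ⊥-elim (p∤-< (s≤s z≤n) n<p p∣n)

    ≡-mod⇒p∣∸ : ∀ x y → x % p ≡ y % p → p ∣ x ∸ y
    ≡-mod⇒p∣∸ x y x≡y = divides (x / p ∸ y / p) (begin
      x ∸ y                                             ≡⟨ cong₂ _∸_ (m≡m%n+[m/n]*n x p) (m≡m%n+[m/n]*n y p) ⟩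
      (x % p ℕ.+ x / p ℕ.* p) ∸ (y % p ℕ.+ y / p ℕ.* p) ≡⟨ cong (λ r → (x % p ℕ.+ x / p ℕ.* p) ∸ (r ℕ.+ y / p ℕ.* p)) (sym x≡y) ⟩
      (x % p ℕ.+ x / p ℕ.* p) ∸ (x % p ℕ.+ y / p ℕ.* p) ≡⟨ ℕP.[m+n]∸[m+o]≡n∸o (x % p) _ _ ⟩
      x / p ℕ.* p ∸ y / p ℕ.* p                         ≡⟨ ℕP.*-distribʳ-∸ p (x / p) (y / p) ⟨
      (x / p ∸ y / p) ℕ.* p                             ∎)
      where open ≡-Reasoning

    *-%-cancel-≤ : ∀ {a} → ¬ p ∣ a → ∀ {c d} → d ≤ c → c < p → (a ℕ.* c) % p ≡ (a ℕ.* d) % p → c ≡ d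
    *-%-cancel-≤ {a} p∤a {c} {d} d≤c c<p ac≡ad
      with euclidsLemma a (c ∸ d) p-prime (subst (p ∣_) (sym (ℕP.*-distribˡ-∸ a c d)) (≡-mod⇒p∣∸ (a ℕ.* c) (a ℕ.* d) ac≡ad))
    ... | inj₁ p∣a   = ⊥-elim (p∤a p∣a)
    ... | inj₂ p∣c∸d = ℕP.≤-antisym (ℕP.m∸n≡0⇒m≤n (p∣-<⇒≡0 (ℕP.≤-<-trans (ℕP.m∸n≤m c d) c<p) p∣c∸d)) d≤c

    *-%-injective : ∀ {a} → ¬ p ∣ a → ∀ {c d} → c < p → d < p → (a ℕ.* c) % p ≡ (a ℕ.* d) % p → c ≡ d
    *-%-injective p∤a {c} {d} c<p d<p ac≡ad with ℕP.≤-total d c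
    ... | inj₁ d≤c = *-%-cancel-≤ p∤a d≤c c<p ac≡ad
    ... | inj₂ c≤d = sym (*-%-cancel-≤ p∤a c≤d d<p (sym ac≡ad))

    -- multiplication by a unit permutes the nonzero residues 1, …, p-1 (shifted down to 0, …, p-2)
    module _ {a} (p∤a : ¬ p ∣ a) where

      private
        1+c<p : ∀ {c} → c < p ∸ 1 → suc c < p
        1+c<p c<p-1 = ℕP.<-≤-trans (s≤s c<p-1) p-1<p

        residue : ℕ → ℕ
        residue c = (a ℕ.* suc c) % p ∸ 1

        suc-residue : ∀ c → c < p ∸ 1 → suc (residue c) ≡ (a ℕ.* suc c) % p
        suc-residue c c<p-1 = ℕP.suc-pred ((a ℕ.* suc c) % p) {{ℕ.≢-nonZero residue≢0}}
          where
          residue≢0 : (a ℕ.* suc c) % p ≢ 0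
          residue≢0 r≡0 = p∤-* p∤a (p∤-< (s≤s z≤n) (1+c<p c<p-1)) (m%n≡0⇒n∣m _ p r≡0)

        residue-< : ∀ c → c < p ∸ 1 → residue c < p ∸ 1
        residue-< c c<p-1 = ℕP.≤-pred (subst₂ _≤_ (cong suc (sym (suc-residue c c<p-1))) (sym (ℕP.suc-pred p))
          (m%n<n (a ℕ.* suc c) p))

        residue-injective : ∀ c d → c < p ∸ 1 → d < p ∸ 1 → residue c ≡ residue d → c ≡ d
        residue-injective c d c<p-1 d<p-1 eq = ℕP.suc-injective (*-%-injective p∤a (1+c<p c<p-1) (1+c<p d<p-1)
          (trans (sym (suc-residue c c<p-1)) (trans (cong suc eq) (suc-residue d d<p-1))))

      ∑-permute-residues : ∀ (g : ℕ → ℚ) → ∑ (p ∸ 1) (λ c → g ((a ℕ.* suc c) % p)) ≡ ∑ (p ∸ 1) (λ c → g (suc c))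
      ∑-permute-residues g = trans (∑-cong (p ∸ 1) (λ c c<p-1 → cong g (sym (suc-residue c c<p-1))))
        (∑-permute (p ∸ 1) residue (λ c → g (suc c)) residue-< residue-injective)

      ∏-permute-residues : ∀ (g : ℕ → ℚ) → ∏ (p ∸ 1) (λ c → g ((a ℕ.* suc c) % p)) ≡ ∏ (p ∸ 1) (λ c → g (suc c))
      ∏-permute-residues g = trans (∏-cong (p ∸ 1) (λ c c<p-1 → cong g (sym (suc-residue c c<p-1))))
        (∏-permute (p ∸ 1) residue (λ c → g (suc c)) residue-< residue-injective)

    p^1∣∏-∏ : ∀ n f g → (∀ c → c < n → p^ 0 ∣ f c) → (∀ c → c < n → p^ 0 ∣ g c) →
      (∀ c → c < n → p^ 1 ∣ (f c - g c)) → p^ 1 ∣ (∏ n f - ∏ n g)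
    p^1∣∏-∏ zero    f g _  _  _   = subst (p^ 1 ∣_) (sym (ℚP.+-inverseʳ 1ℚ)) p^∣0
    p^1∣∏-∏ (suc n) f g df dg dfg = subst (p^ 1 ∣_) (telescope (∏ n f) (∏ n g) (f n) (g n))
      (p^∣-+ (p^∣-*ˡ (p^0∣∏ n f df′) (dfg n (ℕP.n<1+n n)))
             (p^∣-*ʳ (p^1∣∏-∏ n f g df′ (below dg) (below dfg)) (dg n (ℕP.n<1+n n))))
      where
      below : ∀ {P : ℕ → Set} → (∀ c → c < suc n → P c) → ∀ c → c < n → P c
      below h c c<n = h c (ℕP.m<n⇒m<1+n c<n)
      df′ : ∀ c → c < n → p^ 0 ∣ f c
      df′ = below df
      p^0∣∏ : ∀ m f → (∀ c → c < m → p^ 0 ∣ f c) → p^ 0 ∣ ∏ m f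
      p^0∣∏ zero    f _  = p^0∣ℕ 1
      p^0∣∏ (suc m) f df = p^∣-*ˡ (p^0∣∏ m f (λ c c<m → df c (ℕP.m<n⇒m<1+n c<m))) (df m (ℕP.n<1+n m))
      telescope : ∀ (a b c d : ℚ) → a * (c - d) + (a - b) * d ≡ a * c - b * d
      telescope = solve-∀ ℚ-ring

    p∤n! : ∀ n → n < p → ¬ p ∣ (n !)
    p∤n! zero    _   p∣1 = p∤1 p∣1
    p∤n! (suc n) n<p p∣n! = p∤-* (p∤-< (s≤s z≤n) n<p) (p∤n! n (ℕP.<-trans (ℕP.n<1+n n) n<p)) p∣n!

    fermat : ∀ b → 0 < b → b < p → p^ 1 ∣ (ℕtoℚ b ^ (p ∸ 1) - 1ℚ)
    fermat b 0<b b<p = subst (p^ 1 ∣_) cancel-n! (p^∣-*ʳ [b^n-1]*n! (p^0∣1/ (n !) (p∤n! n p-1<p)))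
      where
      instance _ = ℕP._!≢0 (p ∸ 1)
      n = p ∸ 1
      F = ∏ n (λ c → ℕtoℚ (suc c))
      p∤b : ¬ p ∣ b
      p∤b = p∤-< 0<b b<p
      products≡ : p^ 1 ∣ (∏ n (λ c → ℕtoℚ (b ℕ.* suc c)) - ∏ n (λ c → ℕtoℚ ((b ℕ.* suc c) % p)))
      products≡ = p^1∣∏-∏ n (λ c → ℕtoℚ (b ℕ.* suc c)) (λ c → ℕtoℚ ((b ℕ.* suc c) % p))
        (λ c _ → p^0∣ℕ (b ℕ.* suc c)) (λ c _ → p^0∣ℕ ((b ℕ.* suc c) % p)) (λ c _ → p^1∣[a-a%p] (b ℕ.* suc c))
      ∏b*suc≡ : ∏ n (λ c → ℕtoℚ (b ℕ.* suc c)) ≡ ℕtoℚ b ^ n * F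
      ∏b*suc≡ = trans (∏-cong n (λ c _ → ℕtoℚ-* b (suc c)))
        (trans (∏-distrib-* n (λ _ → ℕtoℚ b) (λ c → ℕtoℚ (suc c))) (cong (_* F) (∏-const n (ℕtoℚ b))))
      [b^n-1]*n! : p^ 1 ∣ ((ℕtoℚ b ^ n - 1ℚ) * ℕtoℚ (n !))
      [b^n-1]*n! = subst (p^ 1 ∣_) (trans (cong₂ _-_ ∏b*suc≡ (∏-permute-residues p∤b ℕtoℚ))
        (trans (factor (ℕtoℚ b ^ n) F) (cong ((ℕtoℚ b ^ n - 1ℚ) *_) (∏-suc≡! n)))) products≡
        where
        factor : ∀ (x f : ℚ) → x * f - f ≡ (x - 1ℚ) * f
        factor = solve-∀ ℚ-ring
      cancel-n! : (ℕtoℚ b ^ n - 1ℚ) * ℕtoℚ (n !) * 1/ (n !) ≡ ℕtoℚ b ^ n - 1ℚ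
      cancel-n! = trans (ℚP.*-assoc (ℕtoℚ b ^ n - 1ℚ) (ℕtoℚ (n !)) (1/ (n !)))
        (trans (cong ((ℕtoℚ b ^ n - 1ℚ) *_) (*-1/ (n !))) (ℚP.*-identityʳ _))

    quadraticTaylor : ℕ → ℚ → ℚ → ℚ
    quadraticTaylor k x y = x ^ suc (suc k) + ℕtoℚ (suc (suc k)) * x ^ suc k * y + ℕtoℚ (suc (suc k) C 2) * x ^ k * (y * y)

    linearTaylor : ℕ → ℚ → ℚ → ℚ
    linearTaylor k x y = x ^ suc (suc k) + ℕtoℚ (suc (suc k)) * x ^ suc k * y

    p^3∣-quadraticTaylor : ∀ k x y → p^ 0 ∣ x → p^ 1 ∣ y → p^ 3 ∣ ((x + y) ^ suc (suc k) - quadraticTaylor k x y)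
    p^3∣-quadraticTaylor zero x y _ _ = subst (p^ 3 ∣_) (sym (trans (cong (λ t → (x + y) ^ 2 - (x ^ 2 + t * x ^ 1 * y + 1ℚ * 1ℚ * (y * y))) (ℕtoℚ-+ 1 1)) (square x y))) p^∣0
      where
      square : ∀ (x y : ℚ) → (x + y) * ((x + y) * 1ℚ) - (x * (x * 1ℚ) + (1ℚ + 1ℚ) * (x * 1ℚ) * y + 1ℚ * 1ℚ * (y * y)) ≡ 0ℚ
      square = solve-∀ ℚ-ring
    p^3∣-quadraticTaylor (suc k) x y dx dy = subst (p^ 3 ∣_) (sym step)
      (p^∣-+ (p^∣-*ˡ (p^∣-+ dx (p^∣-weaken z≤n dy)) (p^3∣-quadraticTaylor k x y dx dy))
             (p^∣-*ˡ (p^∣-*ˡ (p^0∣ℕ (suc (suc k) C 2)) (p^0∣-^ k dx)) (p^∣-* dy (p^∣-* dy dy))))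
      where
      A = ℕtoℚ (suc (suc k))
      Cₖ = ℕtoℚ (suc (suc k) C 2)
      A+1 : ℕtoℚ (suc (suc (suc k))) ≡ 1ℚ + A
      A+1 = ℕtoℚ-+ 1 (suc (suc k))
      pascal : ℕtoℚ (suc (suc (suc k)) C 2) ≡ A + Cₖ
      pascal = trans (cong ℕtoℚ (sym (nCk+nC[k+1]≡[n+1]C[k+1] (suc (suc k)) 1)))
        (trans (ℕtoℚ-+ (suc (suc k) C 1) (suc (suc k) C 2)) (cong (_+ Cₖ) (cong ℕtoℚ (nC1≡n (suc (suc k))))))
      expand : ∀ (x y X Z A C : ℚ) →
        (x + y) * Z - (x * (x * (x * X)) + (1ℚ + A) * (x * (x * X)) * y + (A + C) * (x * X) * (y * y))
          ≡ (x + y) * (Z - (x * (x * X) + A * (x * X) * y + C * X * (y * y))) + C * X * (y * (y * y))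
      expand = solve-∀ ℚ-ring
      step : (x + y) ^ suc (suc (suc k)) - quadraticTaylor (suc k) x y
           ≡ (x + y) * ((x + y) ^ suc (suc k) - quadraticTaylor k x y) + Cₖ * x ^ k * (y * (y * y))
      step = trans (cong₂ (λ a c → (x + y) ^ suc (suc (suc k)) - (x ^ suc (suc (suc k)) + a * x ^ suc (suc k) * y + c * x ^ suc k * (y * y))) A+1 pascal)
        (expand x y (x ^ k) ((x + y) ^ suc (suc k)) A Cₖ)

    p^2∣-linearTaylor : ∀ k x y → p^ 0 ∣ x → p^ 1 ∣ y → p^ 2 ∣ ((x + y) ^ suc (suc k) - linearTaylor k x y)
    p^2∣-linearTaylor k x y dx dy = subst (p^ 2 ∣_) (drop-square ((x + y) ^ suc (suc k)) (linearTaylor k x y) (ℕtoℚ (suc (suc k) C 2) * x ^ k * (y * y)))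
      (p^∣-+ (p^∣-weaken-suc (p^3∣-quadraticTaylor k x y dx dy))
             (p^∣-*ˡ (p^∣-*ˡ (p^0∣ℕ (suc (suc k) C 2)) (p^0∣-^ k dx)) (p^∣-* dy dy)))
      where
      drop-square : ∀ (z m c : ℚ) → z - (m + c) + c ≡ z - m
      drop-square = solve-∀ ℚ-ring

    -- the trapezoid rule for ∫ₓ^{x+y} N t^{N-1} dt = (x + y)^N - x^N, which is exact up to O(y³)
    trapezoidError : ℕ → ℚ → ℚ → ℚ
    trapezoidError n x y = ℕtoℚ (3 ℕ.+ n) * ((x + y) ^ (2 ℕ.+ n) + x ^ (2 ℕ.+ n)) * y - (1ℚ + 1ℚ) * ((x + y) ^ (3 ℕ.+ n) - x ^ (3 ℕ.+ n))

    p^3∣trapezoidError : ∀ n x y → p^ 0 ∣ x → p^ 1 ∣ y → p^ 3 ∣ trapezoidError n x y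
    p^3∣trapezoidError n x y dx dy = subst (p^ 3 ∣_) combine
      (p^∣-- (p^∣-* (p^∣-*ˡ (p^0∣ℕ (3 ℕ.+ n)) (p^2∣-linearTaylor n x y dx dy)) dy)
             (p^∣-*ˡ (subst (p^ 0 ∣_) (ℕtoℚ-+ 1 1) (p^0∣ℕ 2)) (p^3∣-quadraticTaylor (suc n) x y dx dy)))
      where
      two = 1ℚ + 1ℚ
      A  = ℕtoℚ (3 ℕ.+ n)
      A′ = ℕtoℚ (2 ℕ.+ n)
      Cₙ = ℕtoℚ ((3 ℕ.+ n) C 2)
      A*A′≡2*Cₙ : A * A′ ≡ two * Cₙ
      A*A′≡2*Cₙ = trans (sym (ℕtoℚ-* (3 ℕ.+ n) (2 ℕ.+ n)))
        (trans (cong ℕtoℚ ([1+m]*m≡2*[1+m]C2 (2 ℕ.+ n))) (trans (ℕtoℚ-* 2 ((3 ℕ.+ n) C 2)) (cong (_* Cₙ) (ℕtoℚ-+ 1 1))))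
      expand : ∀ (x y X Z′ Z A A′ C : ℚ) →
        A * (Z′ - (x * X + A′ * X * y)) * y - (1ℚ + 1ℚ) * (Z - (x * (x * X) + A * (x * X) * y + C * X * (y * y)))
          ≡ A * (Z′ + x * X) * y - (1ℚ + 1ℚ) * (Z - x * (x * X)) - (A * A′ - (1ℚ + 1ℚ) * C) * X * (y * y)
      expand = solve-∀ ℚ-ring
      vanish : ∀ (w c u v : ℚ) → w - (c - c) * u * v ≡ w
      vanish = solve-∀ ℚ-ring
      combine : A * ((x + y) ^ (2 ℕ.+ n) - linearTaylor n x y) * y - two * ((x + y) ^ (3 ℕ.+ n) - quadraticTaylor (suc n) x y)
              ≡ trapezoidError n x y
      combine = trans (expand x y (x ^ suc n) ((x + y) ^ (2 ℕ.+ n)) ((x + y) ^ (3 ℕ.+ n)) A A′ Cₙ)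
        (trans (cong (λ t → A * ((x + y) ^ (2 ℕ.+ n) + x * x ^ suc n) * y - two * ((x + y) ^ (3 ℕ.+ n) - x * (x * x ^ suc n)) - (t - two * Cₙ) * x ^ suc n * (y * y)) A*A′≡2*Cₙ)
          (vanish _ (two * Cₙ) (x ^ suc n) (y * y)))

    -- Power sums modulo powers of p

    module _ (5≤p : 5 ≤ p) where

      4+n≤5^n : ∀ n → 1 ≤ n → 4 ℕ.+ n ≤ 5 ℕ.^ n
      4+n≤5^n (suc zero)    _ = ℕP.≤-refl
      4+n≤5^n (suc (suc n)) _ = begin
        suc (4 ℕ.+ suc n)   ≤⟨ s≤s (4+n≤5^n (suc n) (s≤s z≤n)) ⟩
        suc a               ≡⟨ ℕP.+-comm 1 a ⟩
        a ℕ.+ 1             ≤⟨ ℕP.+-monoʳ-≤ a (ℕP.≤-trans (ℕP.m^n>0 5 (suc n)) (ℕP.m≤n*m a 4)) ⟩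
        a ℕ.+ 4 ℕ.* a       ∎
        where
        open ℕP.≤-Reasoning
        a = 5 ℕ.^ suc n

      p^c∣p^[m-1]/m : ∀ c m → c ≤ 3 → c < m → p^ c ∣ (ℕtoℚ p ^ (m ∸ 1) * recip m)
      p^c∣p^[m-1]/m c m c≤3 c<m with p-adic-decomposition m (ℕP.≤-trans (s≤s z≤n) c<m)
      ... | v , w , m≡ , p∤w = p^∣-p^n*recip v w m≡ p∤w
        (ℕP.m+n≤o⇒m≤o∸n (c ℕ.+ v) (subst (_≤ m) (ℕP.+-comm 1 (c ℕ.+ v)) (c+v<m v m≡)))
        where
        c+v<m : ∀ v → m ≡ p ℕ.^ v ℕ.* w → c ℕ.+ v < m
        c+v<m zero    _  = subst (_< m) (sym (ℕP.+-identityʳ c)) c<m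
        c+v<m (suc u) m≡ = begin-strict
          c ℕ.+ suc u       <⟨ s≤s (ℕP.+-monoˡ-≤ (suc u) c≤3) ⟩
          4 ℕ.+ suc u       ≤⟨ 4+n≤5^n (suc u) (s≤s z≤n) ⟩
          5 ℕ.^ suc u       ≤⟨ ℕP.^-monoˡ-≤ (suc u) 5≤p ⟩
          p ℕ.^ suc u       ≤⟨ ℕP.m≤m*n (p ℕ.^ suc u) w {{w≢0}} ⟩
          p ℕ.^ suc u ℕ.* w ≡⟨ m≡ ⟨
          m                 ∎
          where
          open ℕP.≤-Reasoning
          w≢0 : NonZero w
          w≢0 = ℕ.≢-nonZero (λ { refl → ℕP.<⇒≢ (ℕP.≤-trans (s≤s z≤n) c<m) (sym (trans m≡ (ℕP.*-zeroʳ (p ℕ.^ suc u)))) })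

      Sₚ : ℕ → ℚ
      Sₚ k = powerSum k p

      faulhaberTerm : ℕ → ℕ → ℚ
      faulhaberTerm k j = ℕtoℚ (k C j) * bernoulli j * (ℕtoℚ p ^ (suc k ∸ j) * recip (suc k ∸ j))

      remainder : ℕ → ℚ
      remainder k = ∑ k (faulhaberTerm k)

      Sₚ≡remainder+p*B : ∀ k → Sₚ k ≡ remainder k + ℕtoℚ p * bernoulli k
      Sₚ≡remainder+p*B k = trans (faulhaber k p) (cong (_+_ (remainder k)) last-term)
        where
        last-term : faulhaberTerm k k ≡ ℕtoℚ p * bernoulli k
        last-term = begin
          ℕtoℚ (k C k) * bernoulli k * (ℕtoℚ p ^ (suc k ∸ k) * recip (suc k ∸ k))
            ≡⟨ cong₂ (λ c e → ℕtoℚ c * bernoulli k * (ℕtoℚ p ^ e * recip e)) (nCn≡1 k) (ℕP.m+n∸n≡m 1 k) ⟩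
          1ℚ * bernoulli k * (ℕtoℚ p * 1ℚ * 1ℚ)  ≡⟨ simplify (bernoulli k) (ℕtoℚ p) ⟩
          ℕtoℚ p * bernoulli k                   ∎
          where
          open ≡-Reasoning
          simplify : ∀ (b q : ℚ) → 1ℚ * b * (q * 1ℚ * 1ℚ) ≡ q * b
          simplify = solve-∀ ℚ-ring

      Sₚ-p*B≡remainder : ∀ k → Sₚ k - ℕtoℚ p * bernoulli k ≡ remainder k
      Sₚ-p*B≡remainder k = trans (cong (_- ℕtoℚ p * bernoulli k) (Sₚ≡remainder+p*B k)) (cancel (remainder k) (ℕtoℚ p * bernoulli k))
        where
        cancel : ∀ (r b : ℚ) → (r + b) - b ≡ r
        cancel = solve-∀ ℚ-ring

      Sₚ-remainder≡p*B : ∀ k → Sₚ k - remainder k ≡ ℕtoℚ p * bernoulli k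
      Sₚ-remainder≡p*B k = trans (cong (_- remainder k) (Sₚ≡remainder+p*B k)) (cancel (remainder k) (ℕtoℚ p * bernoulli k))
        where
        cancel : ∀ (r b : ℚ) → (r + b) - r ≡ b
        cancel = solve-∀ ℚ-ring

      c<1+k∸j : ∀ c k j → j ℕ.+ c ≤ k → c < suc k ∸ j
      c<1+k∸j c k j j+c≤k = subst (c <_) (sym (ℕP.+-∸-assoc 1 (ℕP.≤-trans (ℕP.m≤m+n j c) j+c≤k)))
        (s≤s (ℕP.m+n≤o⇒m≤o∸n c (subst (_≤ k) (ℕP.+-comm j c) j+c≤k)))

      p^∣-faulhaberTerm : ∀ {c} k j → j < k → p^ 0 ∣ (ℕtoℚ p * bernoulli j) →
        p^ c ∣ (ℕtoℚ p ^ (suc k ∸ j ∸ 1) * recip (suc k ∸ j)) → p^ c ∣ faulhaberTerm k j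
      p^∣-faulhaberTerm k j j<k dpB dQ = subst (p^ _ ∣_) regroup (p^∣-*ˡ (p^∣-*ˡ (p^0∣ℕ (k C j)) dpB) dQ)
        where
        m = suc k ∸ j
        p^m≡p*p^[m-1] : ℕtoℚ p ^ m ≡ ℕtoℚ p * ℕtoℚ p ^ (m ∸ 1)
        p^m≡p*p^[m-1] = cong (ℕtoℚ p ^_) (sym (ℕP.suc-pred m {{ℕ.>-nonZero (ℕP.m<n⇒0<n∸m (ℕP.m<n⇒m<1+n j<k))}}))
        regroup : ℕtoℚ (k C j) * (ℕtoℚ p * bernoulli j) * (ℕtoℚ p ^ (m ∸ 1) * recip m) ≡ faulhaberTerm k j
        regroup = trans (rearrange (ℕtoℚ (k C j)) (ℕtoℚ p) (bernoulli j) (ℕtoℚ p ^ (m ∸ 1)) (recip m))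
          (cong (λ t → ℕtoℚ (k C j) * bernoulli j * (t * recip m)) (sym p^m≡p*p^[m-1]))
          where
          rearrange : ∀ (c q b x r : ℚ) → c * (q * b) * (x * r) ≡ c * b * ((q * x) * r)
          rearrange = solve-∀ ℚ-ring

      p^∣-faulhaberTerm′ : ∀ {a b} k j → p^ a ∣ bernoulli j → p^ b ∣ (ℕtoℚ p ^ (suc k ∸ j) * recip (suc k ∸ j)) →
        p^ (a ℕ.+ b) ∣ faulhaberTerm k j
      p^∣-faulhaberTerm′ k j dB dQ = p^∣-* (p^∣-*ˡ (p^0∣ℕ (k C j)) dB) dQ

      p^1∣remainder : ∀ k → (∀ j → j < k → p^ 0 ∣ (ℕtoℚ p * bernoulli j)) → p^ 1 ∣ remainder k
      p^1∣remainder k dpB = p^∣-∑ k (faulhaberTerm k) λ j j<k →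
        p^∣-faulhaberTerm k j j<k (dpB j j<k)
          (p^c∣p^[m-1]/m 1 (suc k ∸ j) (s≤s z≤n) (c<1+k∸j 1 k j (subst (_≤ k) (ℕP.+-comm 1 j) j<k)))

      p^0∣Sₚ : ∀ k → p^ 0 ∣ Sₚ k
      p^0∣Sₚ k = p^∣-∑ p (λ b → ℕtoℚ b ^ k) (λ b _ → p^0∣-^ k (p^0∣ℕ b))

      p^0∣p*bernoulli : ∀ k → p^ 0 ∣ (ℕtoℚ p * bernoulli k)
      p^0∣p*bernoulli = <-rec (λ k → p^ 0 ∣ (ℕtoℚ p * bernoulli k)) λ k rec →
        subst (p^ 0 ∣_) (Sₚ-remainder≡p*B k)
          (p^∣-- (p^0∣Sₚ k) (p^∣-weaken-suc (p^1∣remainder k (λ j j<k → rec j<k))))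

      p^1∣Sₚ-p*B : ∀ k → p^ 1 ∣ (Sₚ k - ℕtoℚ p * bernoulli k)
      p^1∣Sₚ-p*B k = subst (p^ 1 ∣_) (sym (Sₚ-p*B≡remainder k)) (p^1∣remainder k (λ j _ → p^0∣p*bernoulli j))

      p^∣-bernoulli : ∀ {c} k → p^ suc c ∣ Sₚ k → p^ suc c ∣ remainder k → p^ c ∣ bernoulli k
      p^∣-bernoulli k dS dR = p^∣-cancel-p (subst (p^ _ ∣_) (Sₚ-remainder≡p*B k) (p^∣-- dS dR))

      p^0∣bernoulli : ∀ k → p^ 1 ∣ Sₚ k → p^ 0 ∣ bernoulli k
      p^0∣bernoulli k dS = p^∣-bernoulli k dS (subst (p^ 1 ∣_) (Sₚ-p*B≡remainder k) (p^1∣Sₚ-p*B k))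

      p^∣-p^e*recip[e] : ∀ {q} e → e ≡ suc q → q < 4 → p^ suc q ∣ (ℕtoℚ p ^ e * recip e)
      p^∣-p^e*recip[e] {q} e refl q<4 = p^∣-*ʳ (p^k∣p^k (suc q)) (p^0∣1/ (suc q) (p∤-< (s≤s z≤n) (ℕP.<-≤-trans (s≤s q<4) 5≤p)))

      p^2∣remainder : ∀ k → p^ 0 ∣ bernoulli (suc k) → p^ 2 ∣ remainder (2 ℕ.+ k)
      p^2∣remainder k dB = p^∣-+ (p^∣-∑ (suc k) (faulhaberTerm K) early) last
        where
        K = 2 ℕ.+ k
        early : ∀ j → j < suc k → p^ 2 ∣ faulhaberTerm K j
        early j (s≤s j≤k) = p^∣-faulhaberTerm K j (s≤s (ℕP.m≤n⇒m≤1+n j≤k)) (p^0∣p*bernoulli j)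
          (p^c∣p^[m-1]/m 2 (suc K ∸ j) (s≤s (s≤s z≤n)) (c<1+k∸j 2 K j (subst (_≤ K) (ℕP.+-comm 2 j) (s≤s (s≤s j≤k)))))
        last : p^ 2 ∣ faulhaberTerm K (suc k)
        last = p^∣-faulhaberTerm′ K (suc k) dB (p^∣-p^e*recip[e] (suc K ∸ suc k) (ℕP.m+n∸n≡m 2 k) (s≤s (s≤s z≤n)))

      p^3∣remainder : ∀ n → p^ 1 ∣ bernoulli (2 ℕ.+ n) → p^ 0 ∣ bernoulli (suc n) → p^ 3 ∣ remainder (3 ℕ.+ n)
      p^3∣remainder n dB₂ dB₁ = p^∣-+ (p^∣-+ (p^∣-∑ (suc n) (faulhaberTerm N) early) third-last) second-last
        where
        N = 3 ℕ.+ n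
        early : ∀ j → j < suc n → p^ 3 ∣ faulhaberTerm N j
        early j (s≤s j≤n) = p^∣-faulhaberTerm N j (s≤s (ℕP.m≤n⇒m≤1+n (ℕP.m≤n⇒m≤1+n j≤n))) (p^0∣p*bernoulli j)
          (p^c∣p^[m-1]/m 3 (suc N ∸ j) ℕP.≤-refl (c<1+k∸j 3 N j (subst (_≤ N) (ℕP.+-comm 3 j) (s≤s (s≤s (s≤s j≤n))))))
        third-last : p^ 3 ∣ faulhaberTerm N (suc n)
        third-last = p^∣-faulhaberTerm′ N (suc n) dB₁ (p^∣-p^e*recip[e] (suc N ∸ suc n) (ℕP.m+n∸n≡m 3 n) (s≤s (s≤s (s≤s z≤n))))
        second-last : p^ 3 ∣ faulhaberTerm N (2 ℕ.+ n)
        second-last = p^∣-faulhaberTerm′ N (2 ℕ.+ n) dB₂ (p^∣-p^e*recip[e] (suc N ∸ (2 ℕ.+ n)) (ℕP.m+n∸n≡m 2 (suc n)) (s≤s (s≤s z≤n)))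

      p^1∣Sₚ-small : ∀ j → j ℕ.+ 2 ≤ p → p^ 1 ∣ Sₚ j
      p^1∣Sₚ-small = <-rec (λ j → j ℕ.+ 2 ≤ p → p^ 1 ∣ Sₚ j) λ j rec j+2≤p →
        let lower = ∑ j (λ i → ℕtoℚ (suc j C i) * Sₚ i)
            [1+j]*Sⱼ≡ : ℕtoℚ p ^ suc j - lower ≡ ℕtoℚ (suc j) * Sₚ j
            [1+j]*Sⱼ≡ = trans (cong (_- lower) (sym (trans (cong (λ c → lower + ℕtoℚ c * Sₚ j) (sym ([1+n]Cn≡1+n j)))
                          (∑-binomial-powerSum j p))))
                        (cancel lower (ℕtoℚ (suc j) * Sₚ j))
            p^1∣lower : p^ 1 ∣ lower
            p^1∣lower = p^∣-∑ j _ (λ i i<j → p^∣-*ˡ (p^0∣ℕ (suc j C i))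
                          (rec i<j (ℕP.≤-trans (ℕP.+-monoˡ-≤ 2 (ℕP.<⇒≤ i<j)) j+2≤p)))
            p∤1+j : ¬ p ∣ suc j
            p∤1+j = p∤-< (s≤s z≤n) (ℕP.<-≤-trans (ℕP.n<1+n (suc j)) (subst (_≤ p) (ℕP.+-comm j 2) j+2≤p))
        in subst (p^ 1 ∣_) (1/-* (suc j) (Sₚ j))
             (p^∣-*ˡ (p^0∣1/ (suc j) p∤1+j)
               (subst (p^ 1 ∣_) [1+j]*Sⱼ≡ (p^∣-- (p^∣-weaken (s≤s z≤n) (p^k∣p^k (suc j))) p^1∣lower)))
        where
        cancel : ∀ (a b : ℚ) → (a + b) - a ≡ b
        cancel = solve-∀ ℚ-ring

      p^1∣y^q-1 : ∀ y q → p^ 0 ∣ y → p^ 1 ∣ (y - 1ℚ) → p^ 1 ∣ (y ^ q - 1ℚ)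
      p^1∣y^q-1 y zero    _  _  = subst (p^ 1 ∣_) (sym (ℚP.+-inverseʳ 1ℚ)) p^∣0
      p^1∣y^q-1 y (suc q) dy dy-1 = subst (p^ 1 ∣_) (telescope y (y ^ q))
        (p^∣-+ (p^∣-*ˡ dy (p^1∣y^q-1 y q dy dy-1)) dy-1)
        where
        telescope : ∀ (y z : ℚ) → y * (z - 1ℚ) + (y - 1ℚ) ≡ y * z - 1ℚ
        telescope = solve-∀ ℚ-ring

      p^1∣Sₚ : ∀ k → 1 ≤ k → ¬ (p ∸ 1) ∣ k → p^ 1 ∣ Sₚ k
      p^1∣Sₚ k 1≤k p-1∤k = subst (p^ 1 ∣_) (cancel (Sₚ k) (Sₚ r))
        (p^∣-+ (p^1∣Sₚ-small r r+2≤p)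
          (subst (p^ 1 ∣_) (∑-distrib-- p (λ b → ℕtoℚ b ^ k) (λ b → ℕtoℚ b ^ r)) (p^∣-∑ p _ b^k≡b^r)))
        where
        instance
          p-1≢0 : NonZero (p ∸ 1)
          p-1≢0 = ℕ.>-nonZero (ℕP.≤-trans (s≤s z≤n) (ℕP.∸-monoˡ-≤ 1 5≤p))
        n = p ∸ 1
        r = k % n
        q = k / n
        1≤r : 1 ≤ r
        1≤r = ℕP.n≢0⇒n>0 (λ r≡0 → p-1∤k (m%n≡0⇒n∣m k n r≡0))
        r+2≤p : r ℕ.+ 2 ≤ p
        r+2≤p = ℕP.≤-trans (ℕP.≤-reflexive (ℕP.+-comm r 2)) (ℕP.≤-trans (s≤s (m%n<n k n)) (ℕP.≤-reflexive (ℕP.suc-pred p)))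
        cancel : ∀ (a b : ℚ) → b + (a - b) ≡ a
        cancel = solve-∀ ℚ-ring
        b^k≡b^r : ∀ b → b < p → p^ 1 ∣ (ℕtoℚ b ^ k - ℕtoℚ b ^ r)
        b^k≡b^r zero    _ = subst (p^ 1 ∣_) (sym (trans (cong₂ _-_ (0^-positive k 1≤k) (0^-positive r 1≤r)) (ℚP.+-inverseʳ 0ℚ))) p^∣0
        b^k≡b^r (suc b) b<p = subst (p^ 1 ∣_) (sym factor)
          (p^∣-*ˡ (p^0∣-^ r (p^0∣ℕ (suc b))) (p^1∣y^q-1 (x ^ n) q (p^0∣-^ n (p^0∣ℕ (suc b))) (fermat (suc b) (s≤s z≤n) b<p)))
          where
          x = ℕtoℚ (suc b)
          factor : x ^ k - x ^ r ≡ x ^ r * ((x ^ n) ^ q - 1ℚ)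
          factor = begin
            x ^ k - x ^ r                   ≡⟨ cong (λ e → x ^ e - x ^ r) (m≡m%n+[m/n]*n k n) ⟩
            x ^ (r ℕ.+ q ℕ.* n) - x ^ r     ≡⟨ cong (_- x ^ r) (^-homo-* x r (q ℕ.* n)) ⟩
            x ^ r * x ^ (q ℕ.* n) - x ^ r   ≡⟨ cong (λ t → x ^ r * t - x ^ r) (trans (cong (x ^_) (ℕP.*-comm q n)) (sym (^-assocʳ x n q))) ⟩
            x ^ r * (x ^ n) ^ q - x ^ r     ≡⟨ factor-out (x ^ r) ((x ^ n) ^ q) ⟩
            x ^ r * ((x ^ n) ^ q - 1ℚ)      ∎
            where
            open ≡-Reasoning
            factor-out : ∀ (a c : ℚ) → a * c - a ≡ a * (c - 1ℚ)
            factor-out = solve-∀ ℚ-ring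

      S′ₚ : ℕ → ℚ
      S′ₚ k = ∑ (p ∸ 1) (λ c → ℕtoℚ (suc c) ^ k)

      Sₚ≡S′ₚ : ∀ k → 1 ≤ k → Sₚ k ≡ S′ₚ k
      Sₚ≡S′ₚ k 1≤k = begin
        ∑ p (λ b → ℕtoℚ b ^ k)                  ≡⟨ cong (λ n → ∑ n (λ b → ℕtoℚ b ^ k)) (sym (ℕP.suc-pred p)) ⟩
        ∑ (suc (p ∸ 1)) (λ b → ℕtoℚ b ^ k)      ≡⟨ ∑-unconsˡ (p ∸ 1) (λ b → ℕtoℚ b ^ k) ⟩
        0ℚ ^ k + S′ₚ k                          ≡⟨ cong (_+ S′ₚ k) (0^-positive k 1≤k) ⟩
        0ℚ + S′ₚ k                              ≡⟨ ℚP.+-identityˡ (S′ₚ k) ⟩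
        S′ₚ k                                   ∎
        where open ≡-Reasoning

      neg-^-even : ∀ t x → (- x) ^ (t ℕ.* 2) ≡ x ^ (t ℕ.* 2)
      neg-^-even zero    x = refl
      neg-^-even (suc t) x = trans (cong (λ z → (- x) * ((- x) * z)) (neg-^-even t x)) (square x (x ^ (t ℕ.* 2)))
        where
        square : ∀ (x z : ℚ) → (- x) * ((- x) * z) ≡ x * (x * z)
        square = solve-∀ ℚ-ring

      neg-^-odd : ∀ t x → (- x) ^ suc (t ℕ.* 2) ≡ - (x ^ suc (t ℕ.* 2))
      neg-^-odd t x = trans (cong ((- x) *_) (neg-^-even t x)) (sym (ℚP.neg-distribˡ-* x (x ^ (t ℕ.* 2))))

      ∑-reflect : ∀ k → ∑ (p ∸ 1) (λ c → ℕtoℚ (p ∸ suc c) ^ k) ≡ S′ₚ k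
      ∑-reflect k = sym (trans (∑-reverse (p ∸ 1) (λ c → ℕtoℚ (suc c) ^ k))
        (∑-cong (p ∸ 1) (λ c c<p-1 → cong (λ t → ℕtoℚ t ^ k)
          (trans (sym (ℕP.+-∸-assoc 1 c<p-1)) (cong (_∸ suc c) (ℕP.suc-pred p))))))

      p^2∣reflected-odd-power : ∀ t b → b ≤ p → let k = suc (suc t ℕ.* 2) in
        p^ 2 ∣ (ℕtoℚ (p ∸ b) ^ k + ℕtoℚ b ^ k - ℕtoℚ k * (ℕtoℚ p * ℕtoℚ b ^ (suc t ℕ.* 2)))
      p^2∣reflected-odd-power t b b≤p = subst (p^ 2 ∣_) expansion≡
        (p^2∣-linearTaylor (suc (t ℕ.* 2)) (- ℕtoℚ b) (ℕtoℚ p) (p^∣-neg (p^0∣ℕ b)) p^1∣p)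
        where
        open ≡-Reasoning
        k = suc (suc t ℕ.* 2)
        x = ℕtoℚ b
        -x+p≡ : - x + ℕtoℚ p ≡ ℕtoℚ (p ∸ b)
        -x+p≡ = trans (ℚP.+-comm (- x) (ℕtoℚ p)) (sym (ℕtoℚ-∸ p b b≤p))
        rearrange : ∀ (u v w z q : ℚ) → u - (- v + w * z * q) ≡ u + v - w * (q * z)
        rearrange = solve-∀ ℚ-ring
        expansion≡ : (- x + ℕtoℚ p) ^ k - linearTaylor (suc (t ℕ.* 2)) (- x) (ℕtoℚ p)
                   ≡ ℕtoℚ (p ∸ b) ^ k + x ^ k - ℕtoℚ k * (ℕtoℚ p * x ^ (suc t ℕ.* 2))
        expansion≡ = begin
          (- x + ℕtoℚ p) ^ k - ((- x) ^ k + ℕtoℚ k * (- x) ^ (suc t ℕ.* 2) * ℕtoℚ p)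
            ≡⟨ cong₂ (λ u v → u ^ k - (v + ℕtoℚ k * (- x) ^ (suc t ℕ.* 2) * ℕtoℚ p)) -x+p≡ (neg-^-odd (suc t) x) ⟩
          ℕtoℚ (p ∸ b) ^ k - (- (x ^ k) + ℕtoℚ k * (- x) ^ (suc t ℕ.* 2) * ℕtoℚ p)
            ≡⟨ cong (λ v → ℕtoℚ (p ∸ b) ^ k - (- (x ^ k) + ℕtoℚ k * v * ℕtoℚ p)) (neg-^-even (suc t) x) ⟩
          ℕtoℚ (p ∸ b) ^ k - (- (x ^ k) + ℕtoℚ k * x ^ (suc t ℕ.* 2) * ℕtoℚ p)
            ≡⟨ rearrange (ℕtoℚ (p ∸ b) ^ k) (x ^ k) (ℕtoℚ k) (x ^ (suc t ℕ.* 2)) (ℕtoℚ p) ⟩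
          ℕtoℚ (p ∸ b) ^ k + x ^ k - ℕtoℚ k * (ℕtoℚ p * x ^ (suc t ℕ.* 2)) ∎

      -- pairing b with p - b
      p^2∣S′ₚ-odd : ∀ t → p^ 1 ∣ S′ₚ (suc t ℕ.* 2) → p^ 2 ∣ S′ₚ (suc (suc t ℕ.* 2))
      p^2∣S′ₚ-odd t dS = subst (p^ 2 ∣_) (1/-* 2 (S′ₚ k))
        (p^∣-*ˡ (p^0∣1/ 2 (p∤-< (s≤s z≤n) (ℕP.<-≤-trans (s≤s (s≤s (s≤s z≤n))) 5≤p)))
          (subst (p^ 2 ∣_) sum≡2*S′ₚ (p^∣-+ (p^∣-∑ n f pair) (p^∣-*ˡ (p^0∣ℕ k) (p^∣-* p^1∣p dS)))))
        where
        k = suc (suc t ℕ.* 2)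
        n = p ∸ 1
        f : ℕ → ℚ
        f c = ℕtoℚ (p ∸ suc c) ^ k + ℕtoℚ (suc c) ^ k - ℕtoℚ k * (ℕtoℚ p * ℕtoℚ (suc c) ^ (suc t ℕ.* 2))
        pair : ∀ c → c < n → p^ 2 ∣ f c
        pair c c<n = p^2∣reflected-odd-power t (suc c) (ℕP.≤-trans c<n (ℕP.m∸n≤m p 1))
        sum≡2*S′ₚ : ∑ n f + ℕtoℚ k * (ℕtoℚ p * S′ₚ (suc t ℕ.* 2)) ≡ ℕtoℚ 2 * S′ₚ k
        sum≡2*S′ₚ = begin
          ∑ n f + W
            ≡⟨ cong (_+ W) (trans (∑-distrib-- n _ _) (cong₂ _-_ (trans (∑-distrib-+ n _ _) (cong (_+ S′ₚ k) (∑-reflect k)))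
                 (sym (*-distribˡ-∑ n (ℕtoℚ k) _)))) ⟩
          (S′ₚ k + S′ₚ k - ℕtoℚ k * ∑ n (λ c → ℕtoℚ p * ℕtoℚ (suc c) ^ (suc t ℕ.* 2))) + W
            ≡⟨ cong (λ s → (S′ₚ k + S′ₚ k - ℕtoℚ k * s) + W) (sym (*-distribˡ-∑ n (ℕtoℚ p) _)) ⟩
          (S′ₚ k + S′ₚ k - W) + W
            ≡⟨ double (S′ₚ k) W ⟩
          ℕtoℚ 2 * S′ₚ k ∎
          where
          open ≡-Reasoning
          W = ℕtoℚ k * (ℕtoℚ p * S′ₚ (suc t ℕ.* 2))
          double : ∀ (s w : ℚ) → (s + s - w) + w ≡ (1ℚ + 1ℚ) * s
          double = solve-∀ ℚ-ring

      -- The floor sum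

      floorSummand : ℕ → ℕ → ℕ → ℕ
      floorSummand N a b = ((a ℕ.* b) ℕ.^ (N ∸ 1) ℕ.+ ((a ℕ.* b) % p) ℕ.^ (N ∸ 1)) ℕ.* ((a ℕ.* b) / p)

      floorSum : ℕ → ℕ → ℕ
      floorSum N a = sumFrom1 (p ∸ 1) (floorSummand N a)

      trapezoidError-divMod : ∀ n m →
        trapezoidError n (ℕtoℚ (m % p)) (ℕtoℚ p * ℕtoℚ (m / p))
          ≡ ℕtoℚ (3 ℕ.+ n) * ℕtoℚ p * ℕtoℚ ((m ℕ.^ (2 ℕ.+ n) ℕ.+ (m % p) ℕ.^ (2 ℕ.+ n)) ℕ.* (m / p))
            - (1ℚ + 1ℚ) * (ℕtoℚ m ^ (3 ℕ.+ n) - ℕtoℚ (m % p) ^ (3 ℕ.+ n))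
      trapezoidError-divMod n m = begin
        ℕtoℚ N * ((r + y) ^ (2 ℕ.+ n) + r ^ (2 ℕ.+ n)) * y - two * ((r + y) ^ N - r ^ N)
          ≡⟨ cong (λ t → ℕtoℚ N * (t ^ (2 ℕ.+ n) + r ^ (2 ℕ.+ n)) * y - two * (t ^ N - r ^ N)) (sym (ℕtoℚ-divMod m p)) ⟩
        ℕtoℚ N * (ℕtoℚ m ^ (2 ℕ.+ n) + r ^ (2 ℕ.+ n)) * (ℕtoℚ p * ℕtoℚ (m / p)) - two * (ℕtoℚ m ^ N - r ^ N)
          ≡⟨ cong (_- two * (ℕtoℚ m ^ N - r ^ N)) (interchange (ℕtoℚ N) _ (ℕtoℚ p) (ℕtoℚ (m / p))) ⟩
        ℕtoℚ N * ℕtoℚ p * ((ℕtoℚ m ^ (2 ℕ.+ n) + r ^ (2 ℕ.+ n)) * ℕtoℚ (m / p)) - two * (ℕtoℚ m ^ N - r ^ N)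
          ≡⟨ cong (λ t → ℕtoℚ N * ℕtoℚ p * t - two * (ℕtoℚ m ^ N - r ^ N)) (sym summand≡) ⟩
        ℕtoℚ N * ℕtoℚ p * ℕtoℚ ((m ℕ.^ (2 ℕ.+ n) ℕ.+ (m % p) ℕ.^ (2 ℕ.+ n)) ℕ.* (m / p)) - two * (ℕtoℚ m ^ N - r ^ N) ∎
        where
        open ≡-Reasoning
        N = 3 ℕ.+ n
        two = 1ℚ + 1ℚ
        r = ℕtoℚ (m % p)
        y = ℕtoℚ p * ℕtoℚ (m / p)
        interchange : ∀ (a b c d : ℚ) → a * b * (c * d) ≡ (a * c) * (b * d)
        interchange = solve-∀ ℚ-ring
        summand≡ : ℕtoℚ ((m ℕ.^ (2 ℕ.+ n) ℕ.+ (m % p) ℕ.^ (2 ℕ.+ n)) ℕ.* (m / p)) ≡ (ℕtoℚ m ^ (2 ℕ.+ n) + r ^ (2 ℕ.+ n)) * ℕtoℚ (m / p)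
        summand≡ = trans (ℕtoℚ-* (m ℕ.^ (2 ℕ.+ n) ℕ.+ (m % p) ℕ.^ (2 ℕ.+ n)) (m / p))
          (cong (_* ℕtoℚ (m / p)) (trans (ℕtoℚ-+ (m ℕ.^ (2 ℕ.+ n)) ((m % p) ℕ.^ (2 ℕ.+ n)))
            (cong₂ _+_ (ℕtoℚ-^ m (2 ℕ.+ n)) (ℕtoℚ-^ (m % p) (2 ℕ.+ n)))))

      -- summing the trapezoid estimate over ab = (ab)₀ + p ⌊ab/p⌋, b = 1, …, p-1
      p^3∣floorSum-identity : ∀ n a → ¬ p ∣ a →
        p^ 3 ∣ (ℕtoℚ (3 ℕ.+ n) * ℕtoℚ p * ℕtoℚ (floorSum (3 ℕ.+ n) a) - (1ℚ + 1ℚ) * (ℕtoℚ a ^ (3 ℕ.+ n) - 1ℚ) * S′ₚ (3 ℕ.+ n))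
      p^3∣floorSum-identity n a p∤a = subst (p^ 3 ∣_) summed (p^∣-∑ (p ∸ 1) W λ c _ →
        subst (p^ 3 ∣_) (trapezoidError-divMod n (a ℕ.* suc c))
          (p^3∣trapezoidError n _ _ (p^0∣ℕ ((a ℕ.* suc c) % p)) (p^∣-*ʳ p^1∣p (p^0∣ℕ ((a ℕ.* suc c) / p)))))
        where
        N = 3 ℕ.+ n
        two = 1ℚ + 1ℚ
        K = ℕtoℚ N * ℕtoℚ p
        G F R W : ℕ → ℚ
        G c = ℕtoℚ (floorSummand N a (suc c))
        F c = ℕtoℚ (a ℕ.* suc c) ^ N
        R c = ℕtoℚ ((a ℕ.* suc c) % p) ^ N
        W c = K * G c - two * (F c - R c)
        ∑F≡ : ∑ (p ∸ 1) F ≡ ℕtoℚ a ^ N * S′ₚ N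
        ∑F≡ = trans (∑-cong (p ∸ 1) (λ c _ → trans (cong (_^ N) (ℕtoℚ-* a (suc c))) (^-distrib-* (ℕtoℚ a) (ℕtoℚ (suc c)) N)))
          (sym (*-distribˡ-∑ (p ∸ 1) (ℕtoℚ a ^ N) (λ c → ℕtoℚ (suc c) ^ N)))
        summed : ∑ (p ∸ 1) W ≡ K * ℕtoℚ (floorSum N a) - two * (ℕtoℚ a ^ N - 1ℚ) * S′ₚ N
        summed = begin
          ∑ (p ∸ 1) W
            ≡⟨ ∑-distrib-- (p ∸ 1) (λ c → K * G c) (λ c → two * (F c - R c)) ⟩
          ∑ (p ∸ 1) (λ c → K * G c) - ∑ (p ∸ 1) (λ c → two * (F c - R c))
            ≡⟨ cong₂ _-_ (sym (*-distribˡ-∑ (p ∸ 1) K G)) (sym (*-distribˡ-∑ (p ∸ 1) two (λ c → F c - R c))) ⟩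
          K * ∑ (p ∸ 1) G - two * ∑ (p ∸ 1) (λ c → F c - R c)
            ≡⟨ cong (λ t → K * ∑ (p ∸ 1) G - two * t) (∑-distrib-- (p ∸ 1) F R) ⟩
          K * ∑ (p ∸ 1) G - two * (∑ (p ∸ 1) F - ∑ (p ∸ 1) R)
            ≡⟨ cong₂ (λ u v → K * u - two * v) (sym (ℕtoℚ-sumFrom1 (p ∸ 1) (floorSummand N a)))
                 (cong₂ _-_ ∑F≡ (∑-permute-residues p∤a (λ t → ℕtoℚ t ^ N))) ⟩
          K * ℕtoℚ (floorSum N a) - two * (ℕtoℚ a ^ N * S′ₚ N - S′ₚ N)
            ≡⟨ factor K (ℕtoℚ (floorSum N a)) two (ℕtoℚ a ^ N) (S′ₚ N) ⟩
          K * ℕtoℚ (floorSum N a) - two * (ℕtoℚ a ^ N - 1ℚ) * S′ₚ N ∎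
          where
          open ≡-Reasoning
          factor : ∀ (k t w u s : ℚ) → k * t - w * (u * s - s) ≡ k * t - w * (u - 1ℚ) * s
          factor = solve-∀ ℚ-ring

      p^3∣S′ₚ-p*bernoulli : ∀ t → ¬ (p ∸ 1) ∣ (suc t ℕ.* 2) →
        p^ 3 ∣ (S′ₚ (suc (suc t) ℕ.* 2) - ℕtoℚ p * bernoulli (suc (suc t) ℕ.* 2))
      p^3∣S′ₚ-p*bernoulli t p-1∤N-2 = subst (p^ 3 ∣_) remainder≡ (p^3∣remainder (suc (t ℕ.* 2)) B[N-1] B[N-2])
        where
        N = suc (suc t) ℕ.* 2
        S[N-2] : p^ 1 ∣ Sₚ (suc t ℕ.* 2)
        S[N-2] = p^1∣Sₚ (suc t ℕ.* 2) (s≤s z≤n) p-1∤N-2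
        B[N-2] : p^ 0 ∣ bernoulli (suc t ℕ.* 2)
        B[N-2] = p^0∣bernoulli (suc t ℕ.* 2) S[N-2]
        S[N-1] : p^ 2 ∣ Sₚ (suc (suc t ℕ.* 2))
        S[N-1] = subst (p^ 2 ∣_) (sym (Sₚ≡S′ₚ (suc (suc t ℕ.* 2)) (s≤s z≤n)))
          (p^2∣S′ₚ-odd t (subst (p^ 1 ∣_) (Sₚ≡S′ₚ (suc t ℕ.* 2) (s≤s z≤n)) S[N-2]))
        B[N-1] : p^ 1 ∣ bernoulli (suc (suc t ℕ.* 2))
        B[N-1] = p^∣-bernoulli (suc (suc t ℕ.* 2)) S[N-1] (p^2∣remainder (suc (t ℕ.* 2)) B[N-2])
        remainder≡ : remainder N ≡ S′ₚ N - ℕtoℚ p * bernoulli N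
        remainder≡ = trans (sym (Sₚ-p*B≡remainder N)) (cong (_- ℕtoℚ p * bernoulli N) (Sₚ≡S′ₚ N (s≤s z≤n)))

      floorSum-congruence : ∀ t a → 2 ≤ a → a ≤ p ∸ 1 → ¬ p ∣ (suc (suc t) ℕ.* 2) → ¬ (p ∸ 1) ∣ (suc t ℕ.* 2) →
        let N = suc (suc t) ℕ.* 2 in
        CongQ p 2 (ℕtoℚ (2 ℕ.* (a ℕ.^ N ∸ 1)) * (bernoulli N * 1/ N)) (ℕtoℚ (floorSum N a))
      floorSum-congruence t a 2≤a a≤p-1 p∤N p-1∤N-2 = p^∣⇒CongQ {x = X} {y = T} (subst (p^ 2 ∣_) divide-by-N
        (p^∣-neg (p^∣-*ˡ (p^0∣1/ N p∤N) (p^∣-cancel-p (subst (p^ 3 ∣_) combine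
          (p^∣-+ (p^3∣floorSum-identity (suc (t ℕ.* 2)) a p∤a)
                 (p^∣-*ˡ (p^∣-*ˡ (subst (p^ 0 ∣_) (ℕtoℚ-+ 1 1) (p^0∣ℕ 2)) (p^∣-- (p^0∣-^ N (p^0∣ℕ a)) (p^0∣ℕ 1)))
                   (p^3∣S′ₚ-p*bernoulli t p-1∤N-2))))))))
        where
        N = suc (suc t) ℕ.* 2
        two = 1ℚ + 1ℚ
        A = ℕtoℚ a ^ N - 1ℚ
        B = bernoulli N
        X = ℕtoℚ (2 ℕ.* (a ℕ.^ N ∸ 1)) * (B * 1/ N)
        T = ℕtoℚ (floorSum N a)
        p∤a : ¬ p ∣ a
        p∤a = p∤-< (ℕP.≤-trans (s≤s z≤n) 2≤a) (ℕP.≤-<-trans a≤p-1 p-1<p)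
        X≡ : X ≡ two * A * (B * 1/ N)
        X≡ = cong (_* (B * 1/ N)) (trans (ℕtoℚ-* 2 (a ℕ.^ N ∸ 1)) (cong₂ _*_ (ℕtoℚ-+ 1 1)
          (trans (ℕtoℚ-∸ (a ℕ.^ N) 1 (ℕP.m^n>0 a {{ℕ.>-nonZero (ℕP.≤-trans (s≤s z≤n) 2≤a)}} N)) (cong (_- 1ℚ) (ℕtoℚ-^ a N)))))
        combine : ℕtoℚ N * ℕtoℚ p * T - two * A * S′ₚ N + two * A * (S′ₚ N - ℕtoℚ p * B) ≡ ℕtoℚ p * (ℕtoℚ N * (T - X))
        combine = begin
          ℕtoℚ N * ℕtoℚ p * T - two * A * S′ₚ N + two * A * (S′ₚ N - ℕtoℚ p * B)
            ≡⟨ expand (ℕtoℚ N) (ℕtoℚ p) T two A (S′ₚ N) B (1/ N) ⟩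
          ℕtoℚ p * (ℕtoℚ N * (T - two * A * (B * 1/ N))) + ℕtoℚ p * two * A * B * (ℕtoℚ N * 1/ N - 1ℚ)
            ≡⟨ cong (λ z → ℕtoℚ p * (ℕtoℚ N * (T - two * A * (B * 1/ N))) + ℕtoℚ p * two * A * B * (z - 1ℚ)) (*-1/ N) ⟩
          ℕtoℚ p * (ℕtoℚ N * (T - two * A * (B * 1/ N))) + ℕtoℚ p * two * A * B * (1ℚ - 1ℚ)
            ≡⟨ vanish (ℕtoℚ p * (ℕtoℚ N * (T - two * A * (B * 1/ N)))) (ℕtoℚ p * two * A * B) ⟩
          ℕtoℚ p * (ℕtoℚ N * (T - two * A * (B * 1/ N)))
            ≡⟨ cong (λ z → ℕtoℚ p * (ℕtoℚ N * (T - z))) (sym X≡) ⟩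
          ℕtoℚ p * (ℕtoℚ N * (T - X)) ∎
          where
          open ≡-Reasoning
          expand : ∀ (n q y w u s b i : ℚ) →
            n * q * y - w * u * s + w * u * (s - q * b) ≡ q * (n * (y - w * u * (b * i))) + q * w * u * b * (n * i - 1ℚ)
          expand = solve-∀ ℚ-ring
          vanish : ∀ (x c : ℚ) → x + c * (1ℚ - 1ℚ) ≡ x
          vanish = solve-∀ ℚ-ring
        divide-by-N : - (1/ N * (ℕtoℚ N * (T - X))) ≡ X - T
        divide-by-N = trans (cong -_ (1/-* N (T - X))) (negate T X)
          where
          negate : ∀ (y x : ℚ) → - (y - x) ≡ x - y
          negate = solve-∀ ℚ-ring

  prime≢2,3⇒5≤ : ∀ {p} → Prime p → p ≢ 2 → p ≢ 3 → 5 ≤ p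
  prime≢2,3⇒5≤ {0} p-prime _ _ = ⊥-elim (¬prime[0] p-prime)
  prime≢2,3⇒5≤ {1} p-prime _ _ = ⊥-elim (¬prime[1] p-prime)
  prime≢2,3⇒5≤ {2} _ p≢2 _ = ⊥-elim (p≢2 refl)
  prime≢2,3⇒5≤ {3} _ _ p≢3 = ⊥-elim (p≢3 refl)
  prime≢2,3⇒5≤ {4} p-prime _ _ = ⊥-elim (composite⇒¬prime composite[4] p-prime)
  prime≢2,3⇒5≤ {suc (suc (suc (suc (suc _))))} _ _ _ = s≤s (s≤s (s≤s (s≤s (s≤s z≤n))))

open PowerSumCongruences using (floorSum-congruence; prime≢2,3⇒5≤)
open import Defs
open import Data.Nat using (ℕ; NonZero; _≤_; _∸_; _^_; _*_; _+_; _%_; _/_; suc; ≢-nonZero⁻¹)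
open import Data.Nat.Divisibility using (_∣_; divides; _∣0)
open import Data.Nat.Primality using (Prime)
open import Data.Integer using (+_)
open import Data.Rational using (ℚ) renaming (_*_ to _*ℚ_; _/_ to _/ℚ_)
open import Relation.Nullary using (¬_)
open import Relation.Binary.PropositionalEquality using (_≢_; refl)
open import Data.Empty using (⊥-elim)

corollary1 : (p : ℕ) → .{{_ : NonZero p}} → Prime p → p ≢ 2 →
    (i : ℕ) → .{{_ : NonZero i}} → 2 ∣ i → ¬ (p ∣ i) → ¬ ((p ∸ 1) ∣ (i ∸ 2)) →
    (a : ℕ) → 2 ≤ a → a ≤ p ∸ 1 →
    CongQ p 2
      (ℕtoℚ (2 * (a ^ i ∸ 1)) *ℚ (bernoulli i *ℚ (+ 1 /ℚ i)))
      (ℕtoℚ (sumFrom1 (p ∸ 1) (λ b →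
        ((a * b) ^ (i ∸ 1) + ((a * b) % p) ^ (i ∸ 1)) * ((a * b) / p))))
corollary1 p p-prime p≢2 i (divides q i≡q*2) p∤i p-1∤i-2 a 2≤a a≤p-1 with q | i≡q*2
... | 0           | i≡0  = ⊥-elim (≢-nonZero⁻¹ i i≡0)
... | 1           | refl = ⊥-elim (p-1∤i-2 ((p ∸ 1) ∣0))
... | suc (suc t) | refl = floorSum-congruence p p-prime 5≤p t a 2≤a a≤p-1 p∤i p-1∤i-2
  where
  5≤p : 5 ≤ p
  5≤p = prime≢2,3⇒5≤ p-prime p≢2 (λ { refl → p-1∤i-2 (divides (suc t) refl) })
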